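{- Let $n\geq 2$ be even, $M\geq 3$, and $0<\beta\leq n$. Then $(n-\beta,\beta)\in\mathrm{HWP}(C_M[n];M,Mn)$ whenever the following conditions both hold: (1) $\beta\equiv\frac{Mn}{2}\pmod 2$; (2) if $Mn\equiv 2\pmod 4$ and $n>2$, then $\beta\neq 1$.
   Context: For a graph $G$ and positive integer $n$, $G[n]$ denotes the lexicographic product of $G$ with the empty graph on $n$ vertices (vertex set $V(G)\times\mathbb{Z}_n$, with $(x,i)(y,j)$ an edge iff $xy\in E(G)$); $C_M$ is a cycle of length $M$. A $C_\ell$-factor of a graph $G$ is a spanning subgraph of $G$ that is a vertex-disjoint union of $\ell$-cycles. $\mathrm{HWP}(G;M,N)$ denotes the set of pairs $(\alpha,\beta)$ of non-negative integers for which $E(G)$ can be partitioned into $\alpha$ $C_M$-factors and $\beta$ $C_N$-factors. -}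

module Defs where

open import Data.Nat using (ℕ; zero; suc; _≤_; _%_)
open import Data.Nat.DivMod using (m%n<n)
open import Data.Fin using (Fin; toℕ; fromℕ<)
open import Data.Product using (Σ; Σ-syntax; _×_; _,_)
open import Data.Sum using (_⊎_; inj₁; inj₂)
open import Relation.Binary.PropositionalEquality using (_≡_)
open import Function.Definitions using (Injective)

record Graph : Set₁ where
  field
    V   : Set
    Adj : V → V → Set
open Graph public

succMod : ∀ {ℓ} → Fin ℓ → Fin ℓ
succMod {suc m} k = fromℕ< (m%n<n (suc (toℕ k)) (suc m))

CycAdj : (M : ℕ) → Fin M → Fin M → Set
CycAdj M x y = (y ≡ succMod x) ⊎ (x ≡ succMod y)

C[_] : (M n : ℕ) → Graph
C[ M ] n = record
  { V   = Fin M × Fin n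
  ; Adj = λ { (x , i) (y , j) → CycAdj M x y } }

record Cycle (G : Graph) (ℓ : ℕ) : Set where
  field
    len≥3    : 3 ≤ ℓ
    vertex   : Fin ℓ → V G
    distinct : Injective _≡_ _≡_ vertex
    adjacent : ∀ k → Adj G (vertex k) (vertex (succMod k))
open Cycle public

EdgeOfCycle : ∀ {G ℓ} → Cycle G ℓ → V G → V G → Set
EdgeOfCycle C u v = Σ[ k ∈ Fin _ ]
  ((vertex C k ≡ u × vertex C (succMod k) ≡ v) ⊎ (vertex C k ≡ v × vertex C (succMod k) ≡ u))

-- A C_ℓ-factor of G: finitely many ℓ-cycles of G such that every vertex of G
-- lies on exactly one of them, at exactly one position (vertex-disjoint and spanning).
record Factor (G : Graph) (ℓ : ℕ) : Set where
  field
    count  : ℕ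
    cycle  : Fin count → Cycle G ℓ
    cover  : ∀ (v : V G) → Σ[ p ∈ Fin count × Fin ℓ ]
               let (i , k) = p in
               (vertex (cycle i) k ≡ v) ×
               (∀ (q : Fin count × Fin ℓ) → let (i' , k') = q in vertex (cycle i') k' ≡ v → q ≡ p)
open Factor public

EdgeOfFactor : ∀ {G ℓ} → Factor G ℓ → V G → V G → Set
EdgeOfFactor F u v = Σ[ i ∈ Fin (count F) ] EdgeOfCycle (cycle F i) u v

InF : ∀ {G M N α β} → (Fin α → Factor G M) → (Fin β → Factor G N) →
      Fin α ⊎ Fin β → V G → V G → Set
InF FM FN (inj₁ a) u v = EdgeOfFactor (FM a) u v
InF FM FN (inj₂ b) u v = EdgeOfFactor (FN b) u v

-- A witness that (α , β) ∈ HWP(G; M, N): α C_M-factors and β C_N-factors of G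
-- whose edge sets partition E(G) (every edge of G lies in exactly one factor;
-- factor edges are edges of G by construction).
record HWP (G : Graph) (M N α β : ℕ) : Set where
  field
    factorM : Fin α → Factor G M
    factorN : Fin β → Factor G N
    partition : ∀ (u v : V G) → Adj G u v →
      Σ[ j ∈ Fin α ⊎ Fin β ]
        (InF factorM factorN j u v ×
         (∀ (j' : Fin α ⊎ Fin β) → InF factorM factorN j' u v → j' ≡ j))

module Submission where

-- A design chooses for each
-- layer x a permutation L_x of ℤ_n; label f ∈ ℤ_n then uses the edges
-- (x , i)(x + 1 , i + L_x(f)).  These n "label factors" partition E(C_M[n]), and the
-- factor of f is n disjoint M-cycles if its total shift S_f = Σ_x L_x(f) is 0 mod n,
-- and a single Hamiltonian (Mn)-cycle if S_f is a unit mod n (LayeredFactors).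
-- So it suffices to build, for every admissible (M, n, β), a design with β unit
-- shifts and n - β zero shifts.  Layers after the first two or three alternate
-- between id and -id and cancel (Alternating).  The leading layers use a
-- pair-flip f ↔ f ± 1 on a range of labels, which produces shifts ±1 there and 0
-- beyond (FlipShifts), together with three-layer blocks built from a perfect
-- shuffle of the two halves of ℤ_{2m} whose sums vanish except at 2 or 3 labels
-- (Blocks).  Four designs cover M even; n = 2; M odd with 4 ∣ n; and M odd with
-- n ≡ 2 (mod 4), n > 2.  The theorem follows by a case analysis on parities.

open import Data.Nat using (ℕ; zero; suc; pred; _+_; _*_; _∸_; _<_; _≤_; _%_; _/_; z≤n; s≤s; s≤s⁻¹; NonZero; >-nonZero; _<?_; _≤?_)
open import Data.Nat.Properties
open import Data.Nat.DivMod
open import Data.Nat.Divisibility using (_∣_; divides)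
open import Data.Nat.Tactic.RingSolver using (solve-∀)
open import Data.Fin using (Fin; toℕ; fromℕ<; cast; join; splitAt; combine; remQuot) renaming (zero to fzero; suc to fsuc)
open import Data.Fin.Properties using (toℕ-injective; toℕ-fromℕ<; toℕ<n; toℕ-cast; toℕ-↑ˡ; toℕ-↑ʳ; join-splitAt; splitAt-join; cast-involutive; toℕ-combine; remQuot-combine; combine-remQuot) renaming (_≟_ to _≟F_)
open import Data.Fin.Permutation using (Permutation′; permutation; _⟨$⟩ʳ_; _⟨$⟩ˡ_; inverseˡ; inverseʳ; _∘ₚ_; transpose)
import Data.Fin.Permutation as Perm
open import Data.List using (List; []; _∷_; length)
open import Data.Product using (Σ; Σ-syntax; _×_; _,_; proj₁; proj₂)
import Data.Product as Product
open import Data.Product.Properties using () renaming (swap-involutive to ×-swap-involutive)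
open import Data.Sum using (_⊎_; inj₁; inj₂)
import Data.Sum as Sum
open import Data.Sum.Properties using () renaming (swap-involutive to ⊎-swap-involutive)
open import Data.Empty using (⊥-elim)
open import Function.Definitions using (Injective)
open import Relation.Nullary using (Dec; yes; no)
open import Relation.Nullary.Decidable using (dec-true; dec-false)
open import Relation.Binary.Bundles using (Setoid)
open import Relation.Binary.Definitions using (tri<; tri≈; tri>)
open import Relation.Binary.PropositionalEquality
import Relation.Binary.Reasoning.Setoid as SetoidReasoning
open import Defs

quotient-mono : ∀ {M x x' q q'} → x < M → q < q' → x + q * M < x' + q' * M
quotient-mono {M} {x} {x'} {q} {q'} x<M q<q' = begin-strict
  x + q * M   <⟨ +-monoˡ-< (q * M) x<M ⟩
  suc q * M   ≤⟨ *-monoˡ-≤ M q<q' ⟩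
  q' * M      ≤⟨ m≤n+m (q' * M) x' ⟩
  x' + q' * M ∎
  where open ≤-Reasoning

divmod-unique : ∀ {M x x' q q'} → x < M → x' < M → x + q * M ≡ x' + q' * M → x ≡ x' × q ≡ q'
divmod-unique {M} {x} {x'} {q} {q'} x<M x'<M eq with <-cmp q q'
... | tri≈ _ refl _ = +-cancelʳ-≡ (q * M) x x' eq , refl
... | tri< q<q' _ _ = ⊥-elim (<-irrefl eq (quotient-mono x<M q<q'))
... | tri> _ _ q>q' = ⊥-elim (<-irrefl (sym eq) (quotient-mono x'<M q>q'))

-- Congruence modulo n on ℕ, and the reduction map ℕ → Fin n = ℤ_n.
-- The relation is wrapped in a record so that both sides stay inferable.
module Modular (n : ℕ) .{{_ : NonZero n}} where

  infix 4 _≈_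
  record _≈_ (a b : ℕ) : Set where
    constructor mod≡
    field mod-eq : a % n ≡ b % n

  ≈-refl : ∀ {a} → a ≈ a
  ≈-refl = mod≡ refl

  ≈-sym : ∀ {a b} → a ≈ b → b ≈ a
  ≈-sym (mod≡ e) = mod≡ (sym e)

  ≈-trans : ∀ {a b c} → a ≈ b → b ≈ c → a ≈ c
  ≈-trans (mod≡ e) (mod≡ f) = mod≡ (trans e f)

  ≡⇒≈ : ∀ {a b} → a ≡ b → a ≈ b
  ≡⇒≈ refl = ≈-refl

  ≈-setoid : Setoid _ _
  ≈-setoid = record
    { Carrier = ℕ ; _≈_ = _≈_
    ; isEquivalence = record { refl = ≈-refl ; sym = ≈-sym ; trans = ≈-trans } }

  module ≈-Reasoning = SetoidReasoning ≈-setoid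

  +-≈ : ∀ {a b c d} → a ≈ b → c ≈ d → a + c ≈ b + d
  +-≈ {a} {b} {c} {d} (mod≡ e) (mod≡ f) = mod≡ (begin
     (a + c) % n         ≡⟨ %-distribˡ-+ a c n ⟩
     (a % n + c % n) % n ≡⟨ cong₂ (λ u v → (u + v) % n) e f ⟩
     (b % n + d % n) % n ≡⟨ %-distribˡ-+ b d n ⟨
     (b + d) % n         ∎)
    where open ≡-Reasoning

  *-≈ : ∀ {a b c d} → a ≈ b → c ≈ d → a * c ≈ b * d
  *-≈ {a} {b} {c} {d} (mod≡ e) (mod≡ f) = mod≡ (begin
     (a * c) % n             ≡⟨ %-distribˡ-* a c n ⟩
     (a % n * (c % n)) % n   ≡⟨ cong₂ (λ u v → (u * v) % n) e f ⟩
     (b % n * (d % n)) % n   ≡⟨ %-distribˡ-* b d n ⟨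
     (b * d) % n             ∎)
    where open ≡-Reasoning

  +ˡ-≈ : ∀ a {c d} → c ≈ d → a + c ≈ a + d
  +ˡ-≈ a = +-≈ (≈-refl {a})

  +ʳ-≈ : ∀ {a b} c → a ≈ b → a + c ≈ b + c
  +ʳ-≈ c e = +-≈ e (≈-refl {c})

  *ˡ-≈ : ∀ a {c d} → c ≈ d → a * c ≈ a * d
  *ˡ-≈ a = *-≈ (≈-refl {a})

  *ʳ-≈ : ∀ {a b} c → a ≈ b → a * c ≈ b * c
  *ʳ-≈ c e = *-≈ e (≈-refl {c})

  +*n≈ : ∀ a k → a + k * n ≈ a
  +*n≈ a k = mod≡ ([m+kn]%n≡m%n a k n)

  *n≈0 : ∀ k → k * n ≈ 0
  *n≈0 k = +*n≈ 0 k

  ≈-by : ∀ {a b} x y → a + x * n ≡ b + y * n → a ≈ b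
  ≈-by {a} {b} x y e = ≈-trans (≈-sym (+*n≈ a x)) (≈-trans (≡⇒≈ e) (+*n≈ b y))

  ≈⇒≡ : ∀ {a b} → a < n → b < n → a ≈ b → a ≡ b
  ≈⇒≡ a<n b<n (mod≡ e) = trans (sym (m<n⇒m%n≡m a<n)) (trans e (m<n⇒m%n≡m b<n))

  -- Subtracting modulo n: n - 1 acts as -1.
  cancel : ∀ {a b} c → a + c ≈ b → a ≈ b + pred n * c
  cancel {a} {b} c h = begin
      a                       ≈⟨ +*n≈ a c ⟨
      a + c * n               ≡⟨ cong (λ m → a + c * m) (suc-pred n) ⟨
      a + c * suc (pred n)    ≡⟨ shuffle a c (pred n) ⟩
      a + c + pred n * c      ≈⟨ +ʳ-≈ (pred n * c) h ⟩
      b + pred n * c          ∎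
    where
      open ≈-Reasoning
      shuffle : ∀ a c n' → a + c * suc n' ≡ a + c + n' * c
      shuffle = solve-∀

  cancel⁻¹ : ∀ a c → a + pred n * c + c ≈ a
  cancel⁻¹ a c = begin
      a + pred n * c + c      ≡⟨ shuffle a c (pred n) ⟩
      a + c * suc (pred n)    ≡⟨ cong (λ m → a + c * m) (suc-pred n) ⟩
      a + c * n               ≈⟨ +*n≈ a c ⟩
      a                       ∎
    where
      open ≈-Reasoning
      shuffle : ∀ a c n' → a + n' * c + c ≡ a + c * suc n'
      shuffle = solve-∀

  ≈-cancelʳ : ∀ {a b} c → a + c ≈ b + c → a ≈ b
  ≈-cancelʳ {a} {b} c h = begin
      a                  ≈⟨ cancel c h ⟩
      b + c + pred n * c ≡⟨ +-assoc b c _ ⟩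
      b + (c + pred n * c) ≡⟨ cong (b +_) (+-comm c _) ⟩
      b + (pred n * c + c) ≡⟨ +-assoc b _ c ⟨
      b + pred n * c + c ≈⟨ cancel⁻¹ b c ⟩
      b                  ∎
    where open ≈-Reasoning

  IsUnit : ℕ → Set
  IsUnit s = Σ ℕ λ t → s * t ≈ 1

  ⟦_⟧ : ℕ → Fin n
  ⟦ a ⟧ = fromℕ< (m%n<n a n)

  toℕ-⟦⟧ : ∀ a → toℕ ⟦ a ⟧ ≡ a % n
  toℕ-⟦⟧ a = toℕ-fromℕ< (m%n<n a n)

  ⟦⟧≈ : ∀ a → toℕ ⟦ a ⟧ ≈ a
  ⟦⟧≈ a = mod≡ (trans (cong (_% n) (toℕ-⟦⟧ a)) (m%n%n≡m%n a n))

  ⟦⟧-cong : ∀ {a b} → a ≈ b → ⟦ a ⟧ ≡ ⟦ b ⟧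
  ⟦⟧-cong {a} {b} (mod≡ e) = toℕ-injective (trans (toℕ-⟦⟧ a) (trans e (sym (toℕ-⟦⟧ b))))

  ⟦toℕ⟧ : ∀ (i : Fin n) → ⟦ toℕ i ⟧ ≡ i
  ⟦toℕ⟧ i = toℕ-injective (trans (toℕ-⟦⟧ (toℕ i)) (m<n⇒m%n≡m (toℕ<n i)))

  toℕ-≈-injective : ∀ {i j : Fin n} → toℕ i ≈ toℕ j → i ≡ j
  toℕ-≈-injective {i} {j} e = toℕ-injective (≈⇒≡ (toℕ<n i) (toℕ<n j) e)

infix 4 _≈⟦_⟧_
_≈⟦_⟧_ : ℕ → (n : ℕ) → .{{NonZero n}} → ℕ → Set
a ≈⟦ n ⟧ b = Modular._≈_ n a b

parity : ∀ x → (Σ ℕ λ g → x ≡ g * 2) ⊎ (Σ ℕ λ g → x ≡ 1 + g * 2)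
parity zero = inj₁ (0 , refl)
parity (suc zero) = inj₂ (0 , refl)
parity (suc (suc x)) with parity x
... | inj₁ (g , e) = inj₁ (suc g , cong (λ z → suc (suc z)) e)
... | inj₂ (g , e) = inj₂ (suc g , cong (λ z → suc (suc z)) e)

toℕ-succMod : ∀ {ℓ'} (k : Fin (suc ℓ')) → toℕ (succMod k) ≡ suc (toℕ k) % suc ℓ'
toℕ-succMod {ℓ'} k = toℕ-fromℕ< (m%n<n (suc (toℕ k)) (suc ℓ'))

succMod-cases : ∀ {ℓ} (k : Fin ℓ) →
  (suc (toℕ k) < ℓ × toℕ (succMod k) ≡ suc (toℕ k)) ⊎ (suc (toℕ k) ≡ ℓ × toℕ (succMod k) ≡ 0)
succMod-cases {suc ℓ'} k with m≤n⇒m<n∨m≡n (toℕ<n k)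
... | inj₁ lt = inj₁ (lt , trans (toℕ-succMod k) (m<n⇒m%n≡m lt))
... | inj₂ eq = inj₂ (eq , trans (toℕ-succMod k) (trans (cong (_% suc ℓ') eq) (n%n≡0 (suc ℓ'))))

-- On a cycle of length at least 3, two steps forward never return to the start;
-- this is why every edge of C_M[n] has a well-defined forward direction.
succMod²≢id : ∀ {ℓ} → 3 ≤ ℓ → (x : Fin ℓ) → succMod (succMod x) ≢ x
succMod²≢id {ℓ} 3≤ℓ x eq with succMod-cases x | succMod-cases (succMod x)
... | inj₁ (_ , e₁) | inj₁ (_ , e₂) =
  <-irrefl (trans (cong toℕ (sym eq)) (trans e₂ (cong suc e₁))) (≤-trans (n<1+n _) (n≤1+n _))
... | inj₁ (_ , e₁) | inj₂ (e₂ , e₂') =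
  <-irrefl (sym (trans (sym e₂) (trans (cong suc e₁) (cong (λ z → suc (suc z)) x≡0)))) 3≤ℓ
  where x≡0 = trans (cong toℕ (sym eq)) e₂'
... | inj₂ (e₁ , e₁') | inj₁ (_ , e₂) =
  <-irrefl (sym (trans (sym e₁) (cong suc x≡1))) 3≤ℓ
  where x≡1 = trans (cong toℕ (sym eq)) (trans e₂ (cong suc e₁'))
... | inj₂ (_ , e₁') | inj₂ (e₂ , _) =
  <-irrefl (sym (trans (sym e₂) (cong suc e₁'))) (≤-trans (s≤s (s≤s z≤n)) 3≤ℓ)

position-bound : ∀ {M n x q} → x < M → q < n → x + q * M < M * n
position-bound {M} {n} {x} {q} x<M q<n = begin-strict
  x + q * M <⟨ +-monoˡ-< (q * M) x<M ⟩
  suc q * M ≤⟨ *-monoˡ-≤ M q<n ⟩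
  n * M     ≡⟨ *-comm n M ⟩
  M * n     ∎
  where open ≤-Reasoning

-- A layered design on ℤ_n assigns to every layer x a permutation ("difference table")
-- of the labels ℤ_n; only the layers x < M are used.
Design : ℕ → Set
Design n = ℕ → Permutation′ n

shift : ∀ {n} → Design n → Fin n → ℕ → ℕ
shift L f zero    = 0
shift L f (suc k) = shift L f k + toℕ (L k ⟨$⟩ʳ f)

-- Label f uses the edges
-- (x , i) (x + 1 , i + L_x(f)); since every L_x is a permutation, each edge of
-- C_M[n] carries exactly one label.
module LayeredFactors (M' n' : ℕ) (M≥3 : 3 ≤ suc M') (L : Design (suc n')) where
  M = suc M'
  n = suc n'
  open Modular n
  module ℤM = Modular M

  G : Graph
  G = C[ M ] n

  diff : ℕ → Fin n → ℕ
  diff x f = toℕ (L x ⟨$⟩ʳ f)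

  σ : Fin n → ℕ → ℕ
  σ = shift L

  step : Fin n → V G → V G
  step f (x , i) = succMod x , ⟦ toℕ i + diff (toℕ x) f ⟧

  step-adjacent : ∀ f u → Adj G u (step f u)
  step-adjacent f (x , i) = inj₁ refl

  following-cycle : ∀ {ℓ} f → 3 ≤ ℓ → (w : Fin ℓ → V G) → Injective _≡_ _≡_ w →
                    (∀ k → w (succMod k) ≡ step f (w k)) → Cycle G ℓ
  following-cycle f 3≤ℓ w inj follows = record
    { len≥3 = 3≤ℓ ; vertex = w ; distinct = inj
    ; adjacent = λ k → subst (Adj G (w k)) (sym (follows k)) (step-adjacent f (w k)) }

  record LabelFactor (f : Fin n) (ℓ : ℕ) : Set where
    field
      factor  : Factor G ℓ
      follows : ∀ c k → vertex (cycle factor c) (succMod k) ≡ step f (vertex (cycle factor c) k)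
  open LabelFactor

  label-edge : ∀ {f ℓ} (F : LabelFactor f ℓ) u → EdgeOfFactor (factor F) u (step f u)
  label-edge F u with cover (factor F) u
  ... | (c , k) , at-u , _ = c , k , inj₁ (at-u , trans (follows F c k) (cong (step _) at-u))

  label-edge-forward : ∀ {f ℓ} (F : LabelFactor f ℓ) (u v : V G) → proj₁ v ≡ succMod (proj₁ u) →
                       EdgeOfFactor (factor F) u v → v ≡ step f u
  label-edge-forward F u v forward (c , k , inj₁ (at-u , at-v)) =
    trans (sym at-v) (trans (follows F c k) (cong (step _) at-u))
  label-edge-forward F u v forward (c , k , inj₂ (at-v , at-u)) =
    ⊥-elim (succMod²≢id M≥3 (proj₁ u) (sym (trans
      (cong proj₁ (trans (sym at-u) (trans (follows F c k) (cong (step _) at-v))))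
      (cong succMod forward))))

  label : Fin M → Fin n → Fin n → Fin n
  label x i j = L (toℕ x) ⟨$⟩ˡ ⟦ toℕ j + n' * toℕ i ⟧

  step-label : ∀ x i j → step (label x i j) (x , i) ≡ (succMod x , j)
  step-label x i j = cong (succMod x ,_) (toℕ-≈-injective (begin
    toℕ ⟦ toℕ i + diff (toℕ x) (label x i j) ⟧ ≈⟨ ⟦⟧≈ _ ⟩
    toℕ i + diff (toℕ x) (label x i j)         ≡⟨ cong (λ z → toℕ i + toℕ z) (inverseʳ (L (toℕ x))) ⟩
    toℕ i + toℕ ⟦ toℕ j + n' * toℕ i ⟧        ≈⟨ +ˡ-≈ (toℕ i) (⟦⟧≈ _) ⟩
    toℕ i + (toℕ j + n' * toℕ i)               ≡⟨ +-comm (toℕ i) _ ⟩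
    toℕ j + n' * toℕ i + toℕ i                 ≈⟨ cancel⁻¹ (toℕ j) (toℕ i) ⟩
    toℕ j                                      ∎))
    where open ≈-Reasoning

  step-injective : ∀ {f g} u → step f u ≡ step g u → f ≡ g
  step-injective {f} {g} (x , i) eq = begin
      f                           ≡⟨ inverseˡ (L (toℕ x)) ⟨
      L (toℕ x) ⟨$⟩ˡ (L (toℕ x) ⟨$⟩ʳ f) ≡⟨ cong (L (toℕ x) ⟨$⟩ˡ_) same-diff ⟩
      L (toℕ x) ⟨$⟩ˡ (L (toℕ x) ⟨$⟩ʳ g) ≡⟨ inverseˡ (L (toℕ x)) ⟩
      g                           ∎
    where
      open ≡-Reasoning
      level : diff (toℕ x) f + toℕ i ≈ diff (toℕ x) g + toℕ i
      level = ≈-trans (≡⇒≈ (+-comm _ (toℕ i))) (≈-trans (≈-sym (⟦⟧≈ _))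
                (≈-trans (≡⇒≈ (cong (λ v → toℕ (proj₂ v)) eq)) (≈-trans (⟦⟧≈ _) (≡⇒≈ (+-comm (toℕ i) _)))))
      same-diff : L (toℕ x) ⟨$⟩ʳ f ≡ L (toℕ x) ⟨$⟩ʳ g
      same-diff = toℕ-≈-injective (≈-cancelʳ (toℕ i) level)

  module ZeroShift (f : Fin n) (zero-shift : σ f M ≈ 0) where

    -- walking once around the base cycle adds σ f M ≡ 0
    σ-succMod : ∀ (k : Fin M) → σ f (toℕ (succMod k)) ≈ σ f (toℕ k) + diff (toℕ k) f
    σ-succMod k with succMod-cases k
    ... | inj₁ (_ , e) = ≡⇒≈ (cong (σ f) e)
    ... | inj₂ (e' , e) = ≈-trans (≡⇒≈ (cong (σ f) e))
                            (≈-trans (≈-sym zero-shift) (≡⇒≈ (cong (σ f) (sym e'))))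

    cycle-vertex : Fin n → Fin M → V G
    cycle-vertex i k = k , ⟦ toℕ i + σ f (toℕ k) ⟧

    cycle-follows : ∀ i k → cycle-vertex i (succMod k) ≡ step f (cycle-vertex i k)
    cycle-follows i k = cong (succMod k ,_) (⟦⟧-cong (begin
        toℕ i + σ f (toℕ (succMod k))                ≈⟨ +ˡ-≈ (toℕ i) (σ-succMod k) ⟩
        toℕ i + (σ f (toℕ k) + diff (toℕ k) f)       ≡⟨ +-assoc (toℕ i) _ _ ⟨
        toℕ i + σ f (toℕ k) + diff (toℕ k) f         ≈⟨ +ʳ-≈ (diff (toℕ k) f) (⟦⟧≈ (toℕ i + σ f (toℕ k))) ⟨
        toℕ ⟦ toℕ i + σ f (toℕ k) ⟧ + diff (toℕ k) f ∎))
      where open ≈-Reasoning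

    cycle-of : V G → Fin n
    cycle-of (x , j) = ⟦ toℕ j + n' * σ f (toℕ x) ⟧

    on-cycle-of : ∀ v → cycle-vertex (cycle-of v) (proj₁ v) ≡ v
    on-cycle-of (x , j) = cong (x ,_) (toℕ-≈-injective (begin
       toℕ ⟦ toℕ ⟦ toℕ j + n' * D ⟧ + D ⟧ ≈⟨ ⟦⟧≈ _ ⟩
       toℕ ⟦ toℕ j + n' * D ⟧ + D         ≈⟨ +ʳ-≈ D (⟦⟧≈ _) ⟩
       toℕ j + n' * D + D                 ≈⟨ cancel⁻¹ (toℕ j) D ⟩
       toℕ j                              ∎))
      where
        open ≈-Reasoning
        D = σ f (toℕ x)

    only-cycle-of : ∀ v (p : Fin n × Fin M) → cycle-vertex (proj₁ p) (proj₂ p) ≡ v →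
                    p ≡ (cycle-of v , proj₁ v)
    only-cycle-of (x , j) (i , k) eq with cong proj₁ eq
    ... | refl = cong (_, k) (toℕ-≈-injective (begin
          toℕ i                    ≈⟨ cancel D level ⟩
          toℕ j + n' * D           ≈⟨ ⟦⟧≈ _ ⟨
          toℕ ⟦ toℕ j + n' * D ⟧   ∎))
      where
        open ≈-Reasoning
        D = σ f (toℕ k)
        level : toℕ i + D ≈ toℕ j
        level = ≈-trans (≈-sym (⟦⟧≈ _)) (≡⇒≈ (cong (λ v → toℕ (proj₂ v)) eq))

    zero-factor : LabelFactor f M
    zero-factor = record
      { factor = record
        { count = n
        ; cycle = λ i → following-cycle f M≥3 (cycle-vertex i) (cong proj₁) (cycle-follows i)
        ; cover = λ v → (cycle-of v , proj₁ v) , on-cycle-of v , only-cycle-of v }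
      ; follows = cycle-follows }

  -- Position
  -- x + q·M (x < M) holds the vertex (x , q·S + σ f x); after M·n steps the
  -- walk closes up, and it visits every vertex because q ↦ q·S is onto ℤ_n.
  module UnitShift (f : Fin n) (t : ℕ) (unit : σ f M * t ≈ 1) where
    S = σ f M

    at : ℕ → ℕ → V G
    at x q = ℤM.⟦ x ⟧ , ⟦ q * S + σ f x ⟧

    position : ℕ → V G
    position P = at (P % M) (P / M)

    position-at : ∀ x q → x < M → position (x + q * M) ≡ at x q
    position-at x q x<M with divmod-unique {M} {P % M} {x} {P / M} {q} (m%n<n P M) x<M (sym (m≡m%n+[m/n]*n P M))
      where P = x + q * M
    ... | x≡ , q≡ = cong₂ at x≡ q≡

    ℤM-⟦⟧ : ∀ x → x < M → toℕ ℤM.⟦ x ⟧ ≡ x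
    ℤM-⟦⟧ x x<M = trans (ℤM.toℕ-⟦⟧ x) (m<n⇒m%n≡m x<M)

    step-at : ∀ {x} q → x < M → step f (at x q) ≡ at (suc x) q
    step-at {x} q x<M = cong₂ _,_ layer (⟦⟧-cong (begin
        toℕ ⟦ q * S + σ f x ⟧ + diff (toℕ ℤM.⟦ x ⟧) f ≡⟨ cong (λ z → toℕ ⟦ q * S + σ f x ⟧ + diff z f) (ℤM-⟦⟧ x x<M) ⟩
        toℕ ⟦ q * S + σ f x ⟧ + diff x f              ≈⟨ +ʳ-≈ (diff x f) (⟦⟧≈ (q * S + σ f x)) ⟩
        q * S + σ f x + diff x f                      ≡⟨ +-assoc (q * S) _ _ ⟩
        q * S + σ f (suc x)                           ∎))
      where
        open ≈-Reasoning
        layer : succMod ℤM.⟦ x ⟧ ≡ ℤM.⟦ suc x ⟧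
        layer = toℕ-injective (trans (toℕ-succMod ℤM.⟦ x ⟧)
                  (trans (cong (λ z → suc z % M) (ℤM-⟦⟧ x x<M)) (sym (ℤM.toℕ-⟦⟧ (suc x)))))

    at-lap : ∀ q → at M q ≡ at 0 (suc q)
    at-lap q = cong₂ _,_ (ℤM.⟦⟧-cong (ℤM.≈-by {M} {0} 0 1 refl))
                         (cong ⟦_⟧ (trans (+-comm (q * S) S) (sym (+-identityʳ _))))

    position-suc : ∀ P → position (suc P) ≡ step f (position P)
    position-suc P with m≤n⇒m<n∨m≡n (m%n<n P M)
    ... | inj₁ sx<M = begin
          position (suc P)         ≡⟨ cong position (cong suc P≡) ⟩
          position (suc x + q * M) ≡⟨ position-at (suc x) q sx<M ⟩
          at (suc x) q             ≡⟨ step-at q (m%n<n P M) ⟨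
          step f (at x q)          ∎
      where
        open ≡-Reasoning
        x = P % M
        q = P / M
        P≡ = m≡m%n+[m/n]*n P M
    ... | inj₂ sx≡M = begin
          position (suc P)         ≡⟨ cong position (trans (cong suc P≡) (cong (_+ q * M) sx≡M)) ⟩
          position (0 + suc q * M) ≡⟨ position-at 0 (suc q) (s≤s z≤n) ⟩
          at 0 (suc q)             ≡⟨ at-lap q ⟨
          at M q                   ≡⟨ cong (λ z → at z q) sx≡M ⟨
          at (suc x) q             ≡⟨ step-at q (m%n<n P M) ⟨
          step f (at x q)          ∎
      where
        open ≡-Reasoning
        x = P % M
        q = P / M
        P≡ = m≡m%n+[m/n]*n P M

    -- after n laps the level is n·S ≡ 0 again
    position-closes : position (M * n) ≡ position 0
    position-closes = begin
      position (M * n)     ≡⟨ cong position (*-comm M n) ⟩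
      position (0 + n * M) ≡⟨ position-at 0 n (s≤s z≤n) ⟩
      at 0 n               ≡⟨ cong (ℤM.⟦ 0 ⟧ ,_) (⟦⟧-cong (≈-trans (≡⇒≈ (+-identityʳ (n * S)))
                                 (≈-trans (≡⇒≈ (*-comm n S)) (*n≈0 S)))) ⟩
      at 0 0               ∎
      where open ≡-Reasoning

    hamilton-vertex : Fin (M * n) → V G
    hamilton-vertex p = position (toℕ p)

    hamilton-follows : ∀ p → hamilton-vertex (succMod p) ≡ step f (hamilton-vertex p)
    hamilton-follows p with succMod-cases p
    ... | inj₁ (_ , e) = trans (cong position e) (position-suc (toℕ p))
    ... | inj₂ (e' , e) = trans (cong position e)
          (trans (sym position-closes) (trans (cong position (sym e')) (position-suc (toℕ p))))

    lap-of : V G → ℕ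
    lap-of (X , j) = toℕ ⟦ t * (toℕ j + n' * σ f (toℕ X)) ⟧

    position-of<Mn : ∀ v → toℕ (proj₁ v) + lap-of v * M < M * n
    position-of<Mn (X , j) = position-bound (toℕ<n X) (toℕ<n ⟦ t * (toℕ j + n' * σ f (toℕ X)) ⟧)

    position-of : V G → Fin (M * n)
    position-of v = fromℕ< (position-of<Mn v)

    at-position-of : ∀ v → hamilton-vertex (position-of v) ≡ v
    at-position-of (X , j) = trans (cong position (toℕ-fromℕ< (position-of<Mn (X , j)))) (trans (position-at (toℕ X) (lap-of (X , j)) (toℕ<n X))
        (cong₂ _,_ (ℤM.⟦toℕ⟧ X) (toℕ-≈-injective (begin
           toℕ ⟦ Q * S + D ⟧                 ≈⟨ ⟦⟧≈ _ ⟩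
           Q * S + D                         ≈⟨ +ʳ-≈ D (*ʳ-≈ S (⟦⟧≈ (t * a))) ⟩
           t * a * S + D                     ≡⟨ cong (_+ D) (reorder t a S) ⟩
           a * (S * t) + D                   ≈⟨ +ʳ-≈ D (*ˡ-≈ a unit) ⟩
           a * 1 + D                         ≡⟨ cong (_+ D) (*-identityʳ a) ⟩
           toℕ j + n' * D + D                ≈⟨ cancel⁻¹ (toℕ j) D ⟩
           toℕ j                             ∎))))
      where
        open ≈-Reasoning
        D = σ f (toℕ X)
        a = toℕ j + n' * D
        Q = lap-of (X , j)
        reorder : ∀ t a S → t * a * S ≡ a * (S * t)
        reorder = solve-∀

    divide-by-S : ∀ q a → q * S ≈ a → q ≈ t * a
    divide-by-S q a qS≈a = begin
      q           ≡⟨ *-identityʳ q ⟨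
      q * 1       ≈⟨ *ˡ-≈ q unit ⟨
      q * (S * t) ≡⟨ reorder q S t ⟩
      t * (q * S) ≈⟨ *ˡ-≈ t qS≈a ⟩
      t * a       ∎
      where
        open ≈-Reasoning
        reorder : ∀ q S t → q * (S * t) ≡ t * (q * S)
        reorder = solve-∀

    only-position-of : ∀ v p → hamilton-vertex p ≡ v → p ≡ position-of v
    only-position-of (X , j) p eq = toℕ-injective (begin
        P                  ≡⟨ m≡m%n+[m/n]*n P M ⟩
        x' + q' * M        ≡⟨ cong₂ (λ a b → a + b * M) x'≡ q'≡ ⟩
        toℕ X + Q * M      ≡⟨ toℕ-fromℕ< _ ⟨
        toℕ (position-of (X , j)) ∎)
      where
        open ≡-Reasoning
        P = toℕ p
        x' = P % M
        q' = P / M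
        Q = lap-of (X , j)
        D = σ f (toℕ X)
        q'<n : q' < n
        q'<n = m<n*o⇒m/o<n (subst (P <_) (*-comm M n) (toℕ<n p))
        x'≡ : x' ≡ toℕ X
        x'≡ = trans (sym (ℤM-⟦⟧ x' (m%n<n P M))) (cong (λ v → toℕ (proj₁ v)) eq)
        level : q' * S + D ≈ toℕ j
        level = ≈-trans (≈-sym (⟦⟧≈ _))
                  (≡⇒≈ (cong (λ v → toℕ (proj₂ v)) (subst (λ z → at z q' ≡ (X , j)) x'≡ eq)))
        q'≡ : q' ≡ Q
        q'≡ = ≈⇒≡ q'<n (toℕ<n ⟦ t * (toℕ j + n' * D) ⟧) (≈-trans (divide-by-S q' _ (cancel D level)) (≈-sym (⟦⟧≈ _)))

    hamilton-factor : LabelFactor f (M * n)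
    hamilton-factor = record
      { factor = record
        { count = 1
        ; cycle = λ _ → following-cycle f (≤-trans M≥3 (m≤m*n M n)) hamilton-vertex
                          (λ {p} {p'} eq → trans (only-position-of _ p refl) (sym (only-position-of _ p' (sym eq))))
                          hamilton-follows
        ; cover = λ v → (fzero , position-of v) , at-position-of v ,
                        λ { (fzero , p) e → cong (fzero ,_) (only-position-of v p e) } }
      ; follows = λ _ → hamilton-follows }

  -- The labels are enumerated as Fin α ⊎ Fin β ≅ Fin (β + α) = Fin n,
  -- the C_{Mn}-factors first.
  module Partition (α β : ℕ) (β+α≡n : β + α ≡ n)
    (zero-shifts : ∀ f → β ≤ toℕ f → σ f M ≈ 0)
    (unit-shifts : ∀ f → toℕ f < β → IsUnit (σ f M)) where

    labelOf : Fin α ⊎ Fin β → Fin n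
    labelOf j = cast β+α≡n (join β α (Sum.swap j))

    indexOf : Fin n → Fin α ⊎ Fin β
    indexOf f = Sum.swap (splitAt β (cast (sym β+α≡n) f))

    labelOf-indexOf : ∀ f → labelOf (indexOf f) ≡ f
    labelOf-indexOf f = begin
      cast β+α≡n (join β α (Sum.swap (Sum.swap (splitAt β (cast _ f))))) ≡⟨ cong (λ s → cast β+α≡n (join β α s)) (⊎-swap-involutive (splitAt β (cast (sym β+α≡n) f))) ⟩
      cast β+α≡n (join β α (splitAt β (cast (sym β+α≡n) f)))             ≡⟨ cong (cast β+α≡n) (join-splitAt β α _) ⟩
      cast β+α≡n (cast (sym β+α≡n) f)                                    ≡⟨ cast-involutive β+α≡n (sym β+α≡n) f ⟩
      f                                                                  ∎
      where open ≡-Reasoning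

    indexOf-labelOf : ∀ j → indexOf (labelOf j) ≡ j
    indexOf-labelOf j = begin
      Sum.swap (splitAt β (cast (sym β+α≡n) (cast β+α≡n (join β α (Sum.swap j)))))
        ≡⟨ cong (λ f → Sum.swap (splitAt β f)) (cast-involutive (sym β+α≡n) β+α≡n _) ⟩
      Sum.swap (splitAt β (join β α (Sum.swap j))) ≡⟨ cong Sum.swap (splitAt-join β α (Sum.swap j)) ⟩
      Sum.swap (Sum.swap j)                        ≡⟨ ⊎-swap-involutive j ⟩
      j                                            ∎
      where open ≡-Reasoning

    zero-label : ∀ a → σ (labelOf (inj₁ a)) M ≈ 0
    zero-label a = zero-shifts _ (subst (β ≤_) (sym (trans (toℕ-cast β+α≡n _) (toℕ-↑ʳ β a))) (m≤m+n β (toℕ a)))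

    unit-label : ∀ b → IsUnit (σ (labelOf (inj₂ b)) M)
    unit-label b = unit-shifts _ (subst (_< β) (sym (trans (toℕ-cast β+α≡n _) (toℕ-↑ˡ b α))) (toℕ<n b))

    factorOf : ∀ j → LabelFactor (labelOf j) (Sum.[ (λ _ → M) , (λ _ → M * n) ]′ j)
    factorOf (inj₁ a) = ZeroShift.zero-factor (labelOf (inj₁ a)) (zero-label a)
    factorOf (inj₂ b) = UnitShift.hamilton-factor (labelOf (inj₂ b)) (proj₁ (unit-label b)) (proj₂ (unit-label b))

    FM : Fin α → Factor G M
    FM a = LabelFactor.factor (factorOf (inj₁ a))

    FN : Fin β → Factor G (M * n)
    FN b = LabelFactor.factor (factorOf (inj₂ b))

    In : Fin α ⊎ Fin β → V G → V G → Set
    In = InF FM FN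

    in-step : ∀ j u → In j u (step (labelOf j) u)
    in-step (inj₁ a) = label-edge (factorOf (inj₁ a))
    in-step (inj₂ b) = label-edge (factorOf (inj₂ b))

    in-forward : ∀ j u v → proj₁ v ≡ succMod (proj₁ u) → In j u v → v ≡ step (labelOf j) u
    in-forward (inj₁ a) = label-edge-forward (factorOf (inj₁ a))
    in-forward (inj₂ b) = label-edge-forward (factorOf (inj₂ b))

    in-sym : ∀ j u v → In j u v → In j v u
    in-sym (inj₁ a) u v (c , k , e) = c , k , Sum.swap e
    in-sym (inj₂ b) u v (c , k , e) = c , k , Sum.swap e

    forward-edge : ∀ x i y j → y ≡ succMod x → Σ[ jj ∈ Fin α ⊎ Fin β ]
      (In jj (x , i) (y , j) × (∀ jj' → In jj' (x , i) (y , j) → jj' ≡ jj))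
    forward-edge x i y j forward = indexOf f , subst (In (indexOf f) (x , i)) reaches (in-step (indexOf f) (x , i)) , unique
      where
        f = label x i j
        hits : step f (x , i) ≡ (y , j)
        hits = trans (step-label x i j) (cong (_, j) (sym forward))
        reaches : step (labelOf (indexOf f)) (x , i) ≡ (y , j)
        reaches = trans (cong (λ g → step g (x , i)) (labelOf-indexOf f)) hits
        unique : ∀ jj' → In jj' (x , i) (y , j) → jj' ≡ indexOf f
        unique jj' e = trans (sym (indexOf-labelOf jj')) (cong indexOf (step-injective (x , i)
          (trans (sym (in-forward jj' (x , i) (y , j) forward e)) (sym hits))))

    edge-in-one : ∀ u v → Adj G u v → Σ[ jj ∈ Fin α ⊎ Fin β ] (In jj u v × (∀ jj' → In jj' u v → jj' ≡ jj))
    edge-in-one (x , i) (y , j) (inj₁ forward) = forward-edge x i y j forward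
    edge-in-one (x , i) (y , j) (inj₂ backward) = backwards (forward-edge y j x i backward)
      where
        backwards : Σ[ jj ∈ Fin α ⊎ Fin β ] (In jj (y , j) (x , i) × (∀ jj' → In jj' (y , j) (x , i) → jj' ≡ jj)) →
                    Σ[ jj ∈ Fin α ⊎ Fin β ] (In jj (x , i) (y , j) × (∀ jj' → In jj' (x , i) (y , j) → jj' ≡ jj))
        backwards (jj , e , unique) = jj , in-sym jj (y , j) (x , i) e , λ jj' e' → unique jj' (in-sym jj' (x , i) (y , j) e')

    hwp : HWP G M (M * n) α β
    hwp = record { factorM = FM ; factorN = FN ; partition = edge-in-one }

transpose-left : ∀ {n} (i j : Fin n) → transpose i j ⟨$⟩ʳ i ≡ j
transpose-left i j rewrite dec-true (i ≟F i) refl = refl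

transpose-right : ∀ {n} (i j : Fin n) → transpose i j ⟨$⟩ʳ j ≡ i
transpose-right i j with j ≟F i
... | yes j≡i = j≡i
... | no _ rewrite dec-true (j ≟F j) refl = refl

transpose-other : ∀ {n} (i j k : Fin n) → k ≢ i → k ≢ j → transpose i j ⟨$⟩ʳ k ≡ k
transpose-other i j k k≢i k≢j rewrite dec-false (k ≟F i) k≢i | dec-false (k ≟F j) k≢j = refl

pairSwap : ℕ → ℕ
pairSwap 0 = 1
pairSwap 1 = 0
pairSwap (suc (suc z)) = suc (suc (pairSwap z))

pairSwap-involutive : ∀ z → pairSwap (pairSwap z) ≡ z
pairSwap-involutive 0 = refl
pairSwap-involutive 1 = refl
pairSwap-involutive (suc (suc z)) = cong (λ w → suc (suc w)) (pairSwap-involutive z)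

pairSwap-< : ∀ k z → z < k * 2 → pairSwap z < k * 2
pairSwap-< (suc k) 0 _ = s≤s (s≤s z≤n)
pairSwap-< (suc k) 1 _ = s≤s z≤n
pairSwap-< (suc k) (suc (suc z)) (s≤s (s≤s h)) = s≤s (s≤s (pairSwap-< k z h))

pairSwap-cases : ∀ z → (Σ ℕ λ j → z ≡ j * 2 × pairSwap z ≡ suc z) ⊎ (Σ ℕ λ j → pairSwap z ≡ j * 2 × suc (pairSwap z) ≡ z)
pairSwap-cases 0 = inj₁ (0 , refl , refl)
pairSwap-cases 1 = inj₂ (0 , refl , refl)
pairSwap-cases (suc (suc z)) with pairSwap-cases z
... | inj₁ (j , e₁ , e₂) = inj₁ (suc j , cong (λ w → suc (suc w)) e₁ , cong (λ w → suc (suc w)) e₂)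
... | inj₂ (j , e₁ , e₂) = inj₂ (suc j , cong (λ w → suc (suc w)) e₁ , cong (λ w → suc (suc w)) e₂)

module Permutations (n' : ℕ) where
  n = suc n'
  open Modular n

  negate : Permutation′ n
  negate = permutation neg neg involutive involutive
    where
      neg : Fin n → Fin n
      neg f = ⟦ n' * toℕ f ⟧
      square : ∀ f n' → n' * (n' * f) + (2 * f) * suc n' ≡ f + (f * suc n') * suc n'
      square = solve-∀
      involutive : ∀ f → neg (neg f) ≡ f
      involutive f = toℕ-≈-injective (begin
        toℕ ⟦ n' * toℕ ⟦ n' * toℕ f ⟧ ⟧ ≈⟨ ⟦⟧≈ (n' * toℕ ⟦ n' * toℕ f ⟧) ⟩
        n' * toℕ ⟦ n' * toℕ f ⟧         ≈⟨ *ˡ-≈ n' (⟦⟧≈ (n' * toℕ f)) ⟩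
        n' * (n' * toℕ f)               ≈⟨ ≈-by (2 * toℕ f) (toℕ f * n) (square (toℕ f) n') ⟩
        toℕ f                           ∎)
        where open ≈-Reasoning

  negate-≈ : ∀ f → toℕ (negate ⟨$⟩ʳ f) ≈ n' * toℕ f
  negate-≈ f = ⟦⟧≈ (n' * toℕ f)

  +negate≈0 : ∀ f → toℕ f + toℕ (negate ⟨$⟩ʳ f) ≈ 0
  +negate≈0 f = begin
      toℕ f + toℕ (negate ⟨$⟩ʳ f) ≈⟨ +ˡ-≈ (toℕ f) (negate-≈ f) ⟩
      n * toℕ f                   ≡⟨ *-comm n (toℕ f) ⟩
      toℕ f * n                   ≈⟨ *n≈0 (toℕ f) ⟩
      0                           ∎
    where open ≈-Reasoning

  n'*n'≈1 : n' * n' ≈ 1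
  n'*n'≈1 = ≈-by 2 n (square n')
    where
      square : ∀ n' → n' * n' + 2 * suc n' ≡ 1 + suc n' * suc n'
      square = solve-∀

  ≈1-unit : ∀ {s} → s ≈ 1 → IsUnit s
  ≈1-unit {s} h = 1 , ≈-trans (≡⇒≈ (*-identityʳ s)) h

  ≈-1-unit : ∀ {s} → s ≈ n' → IsUnit s
  ≈-1-unit {s} h = n' , ≈-trans (*ʳ-≈ n' h) n'*n'≈1

  translate : ℕ → Permutation′ n
  translate t = permutation (λ f → ⟦ toℕ f + t ⟧) (λ f → ⟦ toℕ f + n' * t ⟧) there-and-back back-and-there
    where
      cancels : ∀ f → f + t + n' * t ≈ f
      cancels f = ≈-trans (≡⇒≈ (shuffle f t n')) (+*n≈ f t)
        where
          shuffle : ∀ f t n' → f + t + n' * t ≡ f + t * suc n'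
          shuffle = solve-∀
      there-and-back : ∀ f → ⟦ toℕ ⟦ toℕ f + n' * t ⟧ + t ⟧ ≡ f
      there-and-back f = toℕ-≈-injective (begin
        toℕ ⟦ toℕ ⟦ toℕ f + n' * t ⟧ + t ⟧ ≈⟨ ⟦⟧≈ (toℕ ⟦ toℕ f + n' * t ⟧ + t) ⟩
        toℕ ⟦ toℕ f + n' * t ⟧ + t         ≈⟨ +ʳ-≈ t (⟦⟧≈ (toℕ f + n' * t)) ⟩
        toℕ f + n' * t + t                 ≈⟨ cancel⁻¹ (toℕ f) t ⟩
        toℕ f                              ∎)
        where open ≈-Reasoning
      back-and-there : ∀ f → ⟦ toℕ ⟦ toℕ f + t ⟧ + n' * t ⟧ ≡ f
      back-and-there f = toℕ-≈-injective (begin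
        toℕ ⟦ toℕ ⟦ toℕ f + t ⟧ + n' * t ⟧ ≈⟨ ⟦⟧≈ (toℕ ⟦ toℕ f + t ⟧ + n' * t) ⟩
        toℕ ⟦ toℕ f + t ⟧ + n' * t         ≈⟨ +ʳ-≈ (n' * t) (⟦⟧≈ (toℕ f + t)) ⟩
        toℕ f + t + n' * t                 ≈⟨ cancels (toℕ f) ⟩
        toℕ f                              ∎)
        where open ≈-Reasoning

  translate-down : ∀ c x → c ≤ n → c ≤ toℕ x → toℕ (translate (n ∸ c) ⟨$⟩ʳ x) ≡ toℕ x ∸ c
  translate-down c x c≤n c≤x = begin
    toℕ ⟦ toℕ x + (n ∸ c) ⟧          ≡⟨ toℕ-⟦⟧ (toℕ x + (n ∸ c)) ⟩
    (toℕ x + (n ∸ c)) % n            ≡⟨ cong (_% n) x+[n∸c]≡ ⟩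
    (toℕ x ∸ c + 1 * n) % n          ≡⟨ [m+kn]%n≡m%n (toℕ x ∸ c) 1 n ⟩
    (toℕ x ∸ c) % n                  ≡⟨ m<n⇒m%n≡m (≤-<-trans (m∸n≤m (toℕ x) c) (toℕ<n x)) ⟩
    toℕ x ∸ c                        ∎
    where
      open ≡-Reasoning
      x+[n∸c]≡ : toℕ x + (n ∸ c) ≡ toℕ x ∸ c + 1 * n
      x+[n∸c]≡ = begin
        toℕ x + (n ∸ c)             ≡⟨ cong (_+ (n ∸ c)) (m∸n+n≡m c≤x) ⟨
        toℕ x ∸ c + c + (n ∸ c)     ≡⟨ +-assoc (toℕ x ∸ c) c (n ∸ c) ⟩
        toℕ x ∸ c + (c + (n ∸ c))   ≡⟨ cong (toℕ x ∸ c +_) (trans (m+[n∸m]≡n c≤n) (sym (+-identityʳ n))) ⟩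
        toℕ x ∸ c + 1 * n           ∎

  translate-wrap : ∀ c x → c ≤ n → toℕ x < c → toℕ (translate (n ∸ c) ⟨$⟩ʳ x) ≡ toℕ x + (n ∸ c)
  translate-wrap c x c≤n x<c = trans (toℕ-⟦⟧ (toℕ x + (n ∸ c)))
    (m<n⇒m%n≡m (<-≤-trans (+-monoˡ-< (n ∸ c) x<c) (≤-reflexive (m+[n∸m]≡n c≤n))))

  module PairFlip (o k : ℕ) (o+2k≤n : o + k * 2 ≤ n) where

    flipped< : ∀ z → z < k * 2 → o + pairSwap z < n
    flipped< z h = <-≤-trans (+-monoʳ-< o (pairSwap-< k z h)) o+2k≤n

    flip-by : ∀ f → Dec (toℕ f < o) → Dec (toℕ f ∸ o < k * 2) → Fin n
    flip-by f (yes _) _        = f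
    flip-by f (no _)  (yes lt) = fromℕ< (flipped< (toℕ f ∸ o) lt)
    flip-by f (no _)  (no _)   = f

    flip : Fin n → Fin n
    flip f = flip-by f (toℕ f <? o) (toℕ f ∸ o <? k * 2)

    data FlipView (f g : Fin n) : Set where
      below  : toℕ f < o → g ≡ f → FlipView f g
      inside : o ≤ toℕ f → (toℕ f ∸ o) < k * 2 → toℕ g ≡ o + pairSwap (toℕ f ∸ o) → FlipView f g
      above  : o ≤ toℕ f → k * 2 ≤ toℕ f ∸ o → g ≡ f → FlipView f g

    flipView : ∀ f → FlipView f (flip f)
    flipView f = view (toℕ f <? o) (toℕ f ∸ o <? k * 2)
      where
        view : ∀ d₁ d₂ → FlipView f (flip-by f d₁ d₂)
        view (yes lt) _       = below lt refl
        view (no ge) (yes lt) = inside (≮⇒≥ ge) lt (toℕ-fromℕ< (flipped< (toℕ f ∸ o) lt))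
        view (no ge) (no ge₂) = above (≮⇒≥ ge) (≮⇒≥ ge₂) refl

    flip-involutive : ∀ f → flip (flip f) ≡ f
    flip-involutive f with flipView f
    ... | below _ e = trans (cong flip e) e
    ... | above _ _ e = trans (cong flip e) e
    ... | inside ge lt e with flipView (flip f)
    ...   | below lt₂ _ = ⊥-elim (<-irrefl refl (<-≤-trans lt₂ (subst (o ≤_) (sym e) (m≤m+n o _))))
    ...   | above _ ge₂ _ = ⊥-elim (<-irrefl refl (<-≤-trans (pairSwap-< k _ lt)
                               (≤-trans ge₂ (≤-reflexive (trans (cong (_∸ o) e) (m+n∸m≡n o _))))))
    ...   | inside _ _ e₂ = toℕ-injective (begin
            toℕ (flip (flip f))                         ≡⟨ e₂ ⟩
            o + pairSwap (toℕ (flip f) ∸ o)             ≡⟨ cong (λ w → o + pairSwap w) (trans (cong (_∸ o) e) (m+n∸m≡n o _)) ⟩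
            o + pairSwap (pairSwap (toℕ f ∸ o))         ≡⟨ cong (o +_) (pairSwap-involutive _) ⟩
            o + (toℕ f ∸ o)                             ≡⟨ m+[n∸m]≡n ge ⟩
            toℕ f                                       ∎)
      where open ≡-Reasoning

    flipPairs : Permutation′ n
    flipPairs = permutation flip flip flip-involutive flip-involutive

module Alternating (n' : ℕ) where
  open Permutations n' public
  open Modular n

  alternating : ℕ → Permutation′ n
  alternating 0             = Perm.id
  alternating 1             = negate
  alternating (suc (suc y)) = alternating y

  _then-alternating : List (Permutation′ n) → Design n
  ([] then-alternating) y             = alternating y
  ((π ∷ πs) then-alternating) zero    = π
  ((π ∷ πs) then-alternating) (suc y) = (πs then-alternating) y

  tail-alternates : ∀ πs y → (πs then-alternating) (length πs + y) ≡ alternating y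
  tail-alternates []       y = refl
  tail-alternates (π ∷ πs) y = tail-alternates πs y

  alternating-even : ∀ k → alternating (k * 2) ≡ Perm.id
  alternating-even zero    = refl
  alternating-even (suc k) = alternating-even k

  alternating-odd : ∀ k → alternating (suc (k * 2)) ≡ negate
  alternating-odd zero    = refl
  alternating-odd (suc k) = alternating-odd k

  -- Each (id, negate) pair of layers contributes f + (-f) ≡ 0 to the shift, so only
  -- the leading layers matter.
  alternating-cancels : ∀ πs f k → shift (πs then-alternating) f (length πs + k * 2) ≈ shift (πs then-alternating) f (length πs)
  alternating-cancels πs f zero = ≡⇒≈ (cong (shift L f) (+-identityʳ b))
    where
      L = πs then-alternating
      b = length πs
  alternating-cancels πs f (suc k) = begin
      shift L f (b + suc k * 2)                         ≡⟨ cong (shift L f) (+-suc b (suc (k * 2))) ⟩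
      shift L f (suc (b + suc (k * 2)))                 ≡⟨ cong (λ z → shift L f (suc z)) (+-suc b (k * 2)) ⟩
      shift L f (b + k * 2) + toℕ (L x ⟨$⟩ʳ f) + toℕ (L (suc x) ⟨$⟩ʳ f)
                                                        ≡⟨ +-assoc (shift L f (b + k * 2)) _ _ ⟩
      shift L f (b + k * 2) + (toℕ (L x ⟨$⟩ʳ f) + toℕ (L (suc x) ⟨$⟩ʳ f))
                                                        ≡⟨ cong₂ (λ u v → shift L f x + (toℕ (u ⟨$⟩ʳ f) + toℕ (v ⟨$⟩ʳ f)))
                                                             (trans (tail-alternates πs (k * 2)) (alternating-even k))
                                                             (trans (cong L (sym (+-suc b (k * 2))))
                                                               (trans (tail-alternates πs (suc (k * 2))) (alternating-odd k))) ⟩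
      shift L f x + (toℕ f + toℕ (negate ⟨$⟩ʳ f))     ≈⟨ +ˡ-≈ (shift L f x) (+negate≈0 f) ⟩
      shift L f x + 0                                  ≡⟨ +-identityʳ _ ⟩
      shift L f (b + k * 2)                            ≈⟨ alternating-cancels πs f k ⟩
      shift L f b                                      ∎
    where
      open ≈-Reasoning
      L = πs then-alternating
      b = length πs
      x = b + k * 2

module Halves (m' : ℕ) where
  m = suc m'
  n' = m' + m
  open Alternating n' public
  open Modular n

  m<n : m < n
  m<n = s≤s (m≤n+m m m')

  n'<n : n' < n
  n'<n = n<1+n n'

  n≡2*m : n ≡ 2 * m
  n≡2*m = cong (m +_) (sym (+-identityʳ m))

  m*2≡n : m * 2 ≡ n
  m*2≡n = trans (*-comm m 2) (sym n≡2*m)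

  halfOf : Fin n → Fin 2 × Fin m
  halfOf f = remQuot m (cast n≡2*m f)

  halfOf-value : ∀ f → toℕ f ≡ toℕ (proj₂ (halfOf f)) + toℕ (proj₁ (halfOf f)) * m
  halfOf-value f = begin
    toℕ f                          ≡⟨ toℕ-cast n≡2*m f ⟨
    toℕ (cast n≡2*m f)             ≡⟨ cong toℕ (combine-remQuot {2} m (cast n≡2*m f)) ⟨
    toℕ (combine r q)              ≡⟨ toℕ-combine r q ⟩
    m * toℕ r + toℕ q              ≡⟨ +-comm (m * toℕ r) (toℕ q) ⟩
    toℕ q + m * toℕ r              ≡⟨ cong (toℕ q +_) (*-comm m (toℕ r)) ⟩
    toℕ q + toℕ r * m              ∎
    where
      open ≡-Reasoning
      r = proj₁ (halfOf f)
      q = proj₂ (halfOf f)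

  interleave : Permutation′ n
  interleave = permutation shuffle unshuffle shuffle-unshuffle unshuffle-shuffle
    where
      shuffle : Fin n → Fin n
      shuffle f = cast m*2≡n (Product.uncurry combine (Product.swap (halfOf f)))
      unshuffle : Fin n → Fin n
      unshuffle g = cast (sym n≡2*m) (Product.uncurry combine (Product.swap (remQuot 2 (cast (sym m*2≡n) g))))
      shuffle-unshuffle : ∀ g → shuffle (unshuffle g) ≡ g
      shuffle-unshuffle g = begin
        cast m*2≡n (Product.uncurry combine (Product.swap (remQuot m (cast n≡2*m (cast (sym n≡2*m) c)))))
          ≡⟨ cong (λ z → cast m*2≡n (Product.uncurry combine (Product.swap (remQuot m z)))) (cast-involutive n≡2*m (sym n≡2*m) c) ⟩
        cast m*2≡n (Product.uncurry combine (Product.swap (remQuot m c)))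
          ≡⟨ cong (λ z → cast m*2≡n (Product.uncurry combine (Product.swap z))) (remQuot-combine (proj₂ p) (proj₁ p)) ⟩
        cast m*2≡n (Product.uncurry combine (Product.swap (Product.swap p)))
          ≡⟨ cong (λ z → cast m*2≡n (Product.uncurry combine z)) (×-swap-involutive p) ⟩
        cast m*2≡n (Product.uncurry combine p)
          ≡⟨ cong (cast m*2≡n) (combine-remQuot {m} 2 (cast (sym m*2≡n) g)) ⟩
        cast m*2≡n (cast (sym m*2≡n) g)
          ≡⟨ cast-involutive m*2≡n (sym m*2≡n) g ⟩
        g ∎
        where
          open ≡-Reasoning
          p = remQuot 2 (cast (sym m*2≡n) g)
          c = Product.uncurry combine (Product.swap p)
      unshuffle-shuffle : ∀ f → unshuffle (shuffle f) ≡ f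
      unshuffle-shuffle f = begin
        cast (sym n≡2*m) (Product.uncurry combine (Product.swap (remQuot 2 (cast (sym m*2≡n) (cast m*2≡n c)))))
          ≡⟨ cong (λ z → cast (sym n≡2*m) (Product.uncurry combine (Product.swap (remQuot 2 z)))) (cast-involutive (sym m*2≡n) m*2≡n c) ⟩
        cast (sym n≡2*m) (Product.uncurry combine (Product.swap (remQuot 2 c)))
          ≡⟨ cong (λ z → cast (sym n≡2*m) (Product.uncurry combine (Product.swap z))) (remQuot-combine (proj₂ p) (proj₁ p)) ⟩
        cast (sym n≡2*m) (Product.uncurry combine (Product.swap (Product.swap p)))
          ≡⟨ cong (λ z → cast (sym n≡2*m) (Product.uncurry combine z)) (×-swap-involutive p) ⟩
        cast (sym n≡2*m) (Product.uncurry combine p)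
          ≡⟨ cong (cast (sym n≡2*m)) (combine-remQuot {2} m (cast n≡2*m f)) ⟩
        cast (sym n≡2*m) (cast n≡2*m f)
          ≡⟨ cast-involutive (sym n≡2*m) n≡2*m f ⟩
        f ∎
        where
          open ≡-Reasoning
          p = halfOf f
          c = Product.uncurry combine (Product.swap p)

  interleave-value : ∀ f → toℕ (interleave ⟨$⟩ʳ f) ≡ toℕ (proj₂ (halfOf f)) * 2 + toℕ (proj₁ (halfOf f))
  interleave-value f = begin
    toℕ (cast m*2≡n (combine q r)) ≡⟨ toℕ-cast m*2≡n (combine q r) ⟩
    toℕ (combine q r)              ≡⟨ toℕ-combine q r ⟩
    2 * toℕ q + toℕ r              ≡⟨ cong (_+ toℕ r) (*-comm 2 (toℕ q)) ⟩
    toℕ q * 2 + toℕ r              ∎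
    where
      open ≡-Reasoning
      r = proj₁ (halfOf f)
      q = proj₂ (halfOf f)

  interleave-lower : ∀ f → toℕ f < m → toℕ (interleave ⟨$⟩ʳ f) ≡ toℕ f * 2
  interleave-lower f f<m with divmod-unique {m} {toℕ f} {toℕ q} {0} {toℕ r} f<m (toℕ<n q)
                                (trans (+-identityʳ (toℕ f)) (halfOf-value f))
    where
      r = proj₁ (halfOf f)
      q = proj₂ (halfOf f)
  ... | f≡q , 0≡r = trans (interleave-value f) (trans (cong₂ (λ a b → a * 2 + b) (sym f≡q) (sym 0≡r)) (+-identityʳ _))

  interleave-upper : ∀ f → m ≤ toℕ f → toℕ (interleave ⟨$⟩ʳ f) ≡ (toℕ f ∸ m) * 2 + 1
  interleave-upper f m≤f with divmod-unique {m} {toℕ f ∸ m} {toℕ q} {1} {toℕ r}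
                                 (m<n+o⇒m∸n<o (toℕ f) m (toℕ<n f)) (toℕ<n q)
                                 (trans (trans (cong (toℕ f ∸ m +_) (+-identityʳ m)) (m∸n+n≡m m≤f)) (halfOf-value f))
    where
      r = proj₁ (halfOf f)
      q = proj₂ (halfOf f)
  ... | a≡q , 1≡r = trans (interleave-value f) (cong₂ (λ a b → a * 2 + b) (sym a≡q) (sym 1≡r))

  rotate : Fin n → Fin n
  rotate f with toℕ f <? m
  ... | yes _ = f
  ... | no _ with suc (toℕ f) <? n
  ...   | yes lt = fromℕ< lt
  ...   | no _ = fromℕ< m<n

  rotate-lower : ∀ f → toℕ f < m → rotate f ≡ f
  rotate-lower f lt with toℕ f <? m
  ... | yes _ = refl
  ... | no ge = ⊥-elim (ge lt)

  rotate-middle : ∀ f → m ≤ toℕ f → suc (toℕ f) < n → toℕ (rotate f) ≡ suc (toℕ f)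
  rotate-middle f ge lt with toℕ f <? m
  ... | yes lt' = ⊥-elim (<-irrefl refl (<-≤-trans lt' ge))
  ... | no _ with suc (toℕ f) <? n
  ...   | yes lt₂ = toℕ-fromℕ< lt₂
  ...   | no ge₂ = ⊥-elim (ge₂ lt)

  rotate-top : ∀ f → toℕ f ≡ n' → toℕ (rotate f) ≡ m
  rotate-top f eq with toℕ f <? m
  ... | yes lt' = ⊥-elim (<-irrefl refl (<-≤-trans lt' (≤-trans (m≤n+m m m') (≤-reflexive (sym eq)))))
  ... | no _ with suc (toℕ f) <? n
  ...   | yes lt = ⊥-elim (<-irrefl refl (≤-trans (≤-reflexive (cong (λ z → suc (suc z)) (sym eq))) lt))
  ...   | no _ = toℕ-fromℕ< m<n

  unrotate : Fin n → Fin n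
  unrotate y with toℕ y <? m
  ... | yes _ = y
  ... | no _ with m <? toℕ y
  ...   | yes _ = fromℕ< (≤-<-trans pred[n]≤n (toℕ<n y))
  ...   | no _ = fromℕ< n'<n

  unrotate-lower : ∀ y → toℕ y < m → unrotate y ≡ y
  unrotate-lower y lt with toℕ y <? m
  ... | yes _ = refl
  ... | no ge = ⊥-elim (ge lt)

  unrotate-middle : ∀ y → m < toℕ y → toℕ (unrotate y) ≡ pred (toℕ y)
  unrotate-middle y gt with toℕ y <? m
  ... | yes lt' = ⊥-elim (<-irrefl refl (<-trans lt' gt))
  ... | no _ with m <? toℕ y
  ...   | yes _ = toℕ-fromℕ< _
  ...   | no ng = ⊥-elim (ng gt)

  unrotate-m : ∀ y → toℕ y ≡ m → toℕ (unrotate y) ≡ n'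
  unrotate-m y eq with toℕ y <? m
  ... | yes lt' = ⊥-elim (<-irrefl eq lt')
  ... | no _ with m <? toℕ y
  ...   | yes gt = ⊥-elim (<-irrefl (sym eq) gt)
  ...   | no _ = toℕ-fromℕ< _

  unrotate-rotate : ∀ f → unrotate (rotate f) ≡ f
  unrotate-rotate f = go (toℕ f <? m) (suc (toℕ f) <? n)
    where
      go : Dec (toℕ f < m) → Dec (suc (toℕ f) < n) → unrotate (rotate f) ≡ f
      go (yes lt) _ = trans (cong unrotate (rotate-lower f lt)) (unrotate-lower f lt)
      go (no ge) (yes lt) = toℕ-injective (trans (unrotate-middle (rotate f) (subst (m <_) (sym e) (s≤s (≮⇒≥ ge)))) (cong pred e))
        where e = rotate-middle f (≮⇒≥ ge) lt
      go (no ge) (no ge₂) = toℕ-injective (trans (unrotate-m (rotate f) (rotate-top f ef)) (sym ef))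
        where
          ef : toℕ f ≡ n'
          ef = ≤-antisym (s≤s⁻¹ (toℕ<n f)) (s≤s⁻¹ (≮⇒≥ ge₂))

  rotate-unrotate : ∀ y → rotate (unrotate y) ≡ y
  rotate-unrotate y = go (toℕ y <? m) (m <? toℕ y)
    where
      go : Dec (toℕ y < m) → Dec (m < toℕ y) → rotate (unrotate y) ≡ y
      go (yes lt) _ = trans (cong rotate (unrotate-lower y lt)) (rotate-lower y lt)
      go (no ge) (yes gt) = toℕ-injective (trans (rotate-middle (unrotate y) ge' lt') (trans (cong suc e) sp))
        where
          instance _ = >-nonZero (<-≤-trans (s≤s z≤n) gt)
          sp : suc (pred (toℕ y)) ≡ toℕ y
          sp = suc-pred (toℕ y)
          e = unrotate-middle y gt
          ge' : m ≤ toℕ (unrotate y)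
          ge' = subst (m ≤_) (sym e) (s≤s⁻¹ (≤-trans gt (≤-reflexive (sym sp))))
          lt' : suc (toℕ (unrotate y)) < n
          lt' = subst (λ z → suc z < n) (sym e) (subst (_< n) (sym sp) (toℕ<n y))
      go (no ge) (no ng) = toℕ-injective (trans (rotate-top (unrotate y) (unrotate-m y ey)) (sym ey))
        where
          ey : toℕ y ≡ m
          ey = ≤-antisym (≮⇒≥ ng) (≮⇒≥ ge)

  rotateUpper : Permutation′ n
  rotateUpper = permutation rotate unrotate rotate-unrotate unrotate-rotate

module FlipShifts (n' o k : ℕ) (o+2k≤n : o + k * 2 ≤ suc n') (S κ B : Fin (suc n') → ℕ)
  (relation : ∀ f → S f + κ f ≈⟦ suc n' ⟧ κ (Permutations.PairFlip.flip n' o k o+2k≤n f) + B f)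
  (B-vanishes : ∀ f → o ≤ toℕ f → B f ≈⟦ suc n' ⟧ 0)
  (consecutive : ∀ f g j → toℕ f ≡ o + j * 2 → toℕ g ≡ suc (toℕ f) → κ g ≡ suc (κ f)) where
  open Permutations n'
  open Modular n
  open PairFlip o k o+2k≤n

  solve-S : ∀ f {a} → κ (flip f) + B f ≈ a + κ f → S f ≈ a
  solve-S f h = ≈-cancelʳ (κ f) (≈-trans (relation f) h)

  below-shift : ∀ f → toℕ f < o → S f ≈ B f
  below-shift f f<o with flipView f
  ... | below _ e = solve-S f (≡⇒≈ (trans (cong (λ g → κ g + B f) e) (+-comm (κ f) (B f))))
  ... | inside o≤f _ _ = ⊥-elim (<⇒≱ f<o o≤f)
  ... | above o≤f _ _ = ⊥-elim (<⇒≱ f<o o≤f)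

  above-zero : ∀ f → o + k * 2 ≤ toℕ f → S f ≈ 0
  above-zero f ge with flipView f
  ... | below f<o _ = ⊥-elim (<⇒≱ f<o (≤-trans (m≤m+n o (k * 2)) ge))
  ... | inside o≤f lt _ = ⊥-elim (<⇒≱ lt (subst (_≤ toℕ f ∸ o) (m+n∸m≡n o (k * 2)) (∸-monoˡ-≤ o ge)))
  ... | above o≤f _ e = solve-S f (begin
        κ (flip f) + B f ≡⟨ cong (λ g → κ g + B f) e ⟩
        κ f + B f        ≈⟨ +ˡ-≈ (κ f) (B-vanishes f o≤f) ⟩
        κ f + 0          ≡⟨ +-comm (κ f) 0 ⟩
        0 + κ f          ∎)
    where open ≈-Reasoning

  inside-unit : ∀ f → o ≤ toℕ f → toℕ f < o + k * 2 → IsUnit (S f)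
  inside-unit f o≤f lt with flipView f
  ... | below f<o _ = ⊥-elim (<⇒≱ f<o o≤f)
  ... | above _ ge _ = ⊥-elim (<⇒≱ lt (≤-trans (+-monoʳ-≤ o ge) (≤-reflexive (m+[n∸m]≡n o≤f))))
  ... | inside _ _ e with pairSwap-cases (toℕ f ∸ o)
  ...   | inj₁ (j , z≡ , up) = ≈1-unit (solve-S f (begin
          κ (flip f) + B f       ≈⟨ +ˡ-≈ (κ (flip f)) (B-vanishes f o≤f) ⟩
          κ (flip f) + 0         ≡⟨ +-identityʳ _ ⟩
          κ (flip f)             ≡⟨ consecutive f (flip f) j f≡ flip≡ ⟩
          1 + κ f                ∎))
    where
      open ≈-Reasoning
      f≡ : toℕ f ≡ o + j * 2
      f≡ = trans (sym (m+[n∸m]≡n o≤f)) (cong (o +_) z≡)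
      flip≡ : toℕ (flip f) ≡ suc (toℕ f)
      flip≡ = trans e (trans (cong (o +_) up) (trans (+-suc o _) (cong suc (m+[n∸m]≡n o≤f))))
  ...   | inj₂ (j , swap≡ , down) = ≈-1-unit (solve-S f (begin
          κ (flip f) + B f       ≈⟨ +ˡ-≈ (κ (flip f)) (B-vanishes f o≤f) ⟩
          κ (flip f) + 0         ≡⟨ +-identityʳ _ ⟩
          κ (flip f)             ≈⟨ +*n≈ (κ (flip f)) 1 ⟨
          κ (flip f) + 1 * n     ≡⟨ rearrange (κ (flip f)) n' ⟩
          n' + suc (κ (flip f))  ≡⟨ cong (n' +_) (consecutive (flip f) f j flip≡ f≡) ⟨
          n' + κ f               ∎))
    where
      open ≈-Reasoning
      rearrange : ∀ a n' → a + 1 * suc n' ≡ n' + suc a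
      rearrange = solve-∀
      flip≡ : toℕ (flip f) ≡ o + j * 2
      flip≡ = trans e (cong (o +_) swap≡)
      f≡ : toℕ f ≡ suc (toℕ (flip f))
      f≡ = trans (sym (m+[n∸m]≡n o≤f)) (trans (cong (o +_) (sym down)) (trans (+-suc o _) (cong suc (sym e))))

-- A block is a permutation C of ℤ_n used together
-- with the identity and rotateUpper; its "block sum" F + rotate F + C F vanishes for
-- all but a few exceptional labels F.  The key observation is that
-- F + rotate F ≡ interleave F (mod n) for every F < n - 1, so C = -interleave would
-- cancel everywhere; C₂ and C₃ perturb this by transpositions.
module Blocks (m' : ℕ) where
  open Halves m' public
  open Modular n

  top : Fin n
  top = fromℕ< n'<n

  mid : Fin n
  mid = fromℕ< m<n

  blockSum : Permutation′ n → Fin n → ℕ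
  blockSum C F = toℕ F + toℕ (rotate F) + toℕ (C ⟨$⟩ʳ F)

  rotate-interleave-lower : ∀ F → toℕ F < m → toℕ F + toℕ (rotate F) ≡ toℕ (interleave ⟨$⟩ʳ F)
  rotate-interleave-lower F F<m = begin
      toℕ F + toℕ (rotate F)  ≡⟨ cong (λ G → toℕ F + toℕ G) (rotate-lower F F<m) ⟩
      toℕ F + toℕ F           ≡⟨ double (toℕ F) ⟩
      toℕ F * 2               ≡⟨ interleave-lower F F<m ⟨
      toℕ (interleave ⟨$⟩ʳ F) ∎
    where
      open ≡-Reasoning
      double : ∀ a → a + a ≡ a * 2
      double = solve-∀

  rotate-interleave-upper : ∀ F → m ≤ toℕ F → toℕ F < n' → toℕ F + toℕ (rotate F) ≈ toℕ (interleave ⟨$⟩ʳ F)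
  rotate-interleave-upper F m≤F F<n' = ≈-by 0 1 (begin
      toℕ F + toℕ (rotate F) + 0 * n  ≡⟨ cong₂ (λ a b → a + b + 0 * n) F≡ (trans (rotate-middle F m≤F (s≤s F<n')) (cong suc F≡)) ⟩
      (m + a) + suc (m + a) + 0 * n   ≡⟨ upper a m ⟩
      a * 2 + 1 + 1 * n               ≡⟨ cong (_+ 1 * n) (interleave-upper F m≤F) ⟨
      toℕ (interleave ⟨$⟩ʳ F) + 1 * n ∎)
    where
      open ≡-Reasoning
      a = toℕ F ∸ m
      F≡ : toℕ F ≡ m + a
      F≡ = sym (m+[n∸m]≡n m≤F)
      upper : ∀ a m → (m + a) + suc (m + a) + 0 * (m + m) ≡ a * 2 + 1 + 1 * (m + m)
      upper = solve-∀

  rotate-interleave : ∀ F → toℕ F < n' → toℕ F + toℕ (rotate F) ≈ toℕ (interleave ⟨$⟩ʳ F)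
  rotate-interleave F F<n' = by-half (toℕ F <? m)
    where
      by-half : Dec (toℕ F < m) → toℕ F + toℕ (rotate F) ≈ toℕ (interleave ⟨$⟩ʳ F)
      by-half (yes F<m) = ≡⇒≈ (rotate-interleave-lower F F<m)
      by-half (no F≮m)  = rotate-interleave-upper F (≮⇒≥ F≮m) F<n'

  block-cancels : ∀ C F → toℕ F < n' → C ⟨$⟩ʳ F ≡ negate ⟨$⟩ʳ (interleave ⟨$⟩ʳ F) → blockSum C F ≈ 0
  block-cancels C F F<n' C≡ = begin
    toℕ F + toℕ (rotate F) + toℕ (C ⟨$⟩ʳ F)                       ≈⟨ +ʳ-≈ (toℕ (C ⟨$⟩ʳ F)) (rotate-interleave F F<n') ⟩
    toℕ (interleave ⟨$⟩ʳ F) + toℕ (C ⟨$⟩ʳ F)                     ≡⟨ cong (λ G → toℕ (interleave ⟨$⟩ʳ F) + toℕ G) C≡ ⟩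
    toℕ (interleave ⟨$⟩ʳ F) + toℕ (negate ⟨$⟩ʳ (interleave ⟨$⟩ʳ F)) ≈⟨ +negate≈0 (interleave ⟨$⟩ʳ F) ⟩
    0                                                             ∎
    where open ≈-Reasoning

  interleave-injective : ∀ {F G} → interleave ⟨$⟩ʳ F ≡ interleave ⟨$⟩ʳ G → F ≡ G
  interleave-injective {F} {G} e = trans (sym (inverseˡ interleave)) (trans (cong (interleave ⟨$⟩ˡ_) e) (inverseˡ interleave))

  interleave-zero : interleave ⟨$⟩ʳ fzero ≡ fzero
  interleave-zero = toℕ-injective (interleave-lower fzero (s≤s z≤n))

  interleave-top : interleave ⟨$⟩ʳ top ≡ top
  interleave-top = toℕ-injective (begin
    toℕ (interleave ⟨$⟩ʳ top) ≡⟨ interleave-upper top m≤top ⟩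
    (toℕ top ∸ m) * 2 + 1     ≡⟨ cong (λ z → (z ∸ m) * 2 + 1) (toℕ-fromℕ< n'<n) ⟩
    (n' ∸ m) * 2 + 1          ≡⟨ cong (λ z → z * 2 + 1) (m+n∸n≡m m' m) ⟩
    m' * 2 + 1                ≡⟨ odd m' ⟩
    n'                        ≡⟨ toℕ-fromℕ< n'<n ⟨
    toℕ top                   ∎)
    where
      open ≡-Reasoning
      m≤top : m ≤ toℕ top
      m≤top = subst (m ≤_) (sym (toℕ-fromℕ< n'<n)) (m≤n+m m m')
      odd : ∀ m' → m' * 2 + 1 ≡ m' + suc m'
      odd = solve-∀

  interleave-mid : toℕ (interleave ⟨$⟩ʳ mid) ≡ 1
  interleave-mid = trans (interleave-upper mid (≤-reflexive (sym (toℕ-fromℕ< m<n))))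
                         (cong (λ z → (z ∸ m) * 2 + 1) (trans (toℕ-fromℕ< m<n) refl) ∙ cong (λ z → z * 2 + 1) (n∸n≡0 m))
    where _∙_ = trans

  negate-zero : negate ⟨$⟩ʳ fzero ≡ fzero
  negate-zero = toℕ-injective (trans (toℕ-⟦⟧ (n' * 0)) (cong (_% n) (*-zeroʳ n')))

  negate-top : toℕ (negate ⟨$⟩ʳ top) ≈ 1
  negate-top = ≈-trans (negate-≈ top) (≈-trans (≡⇒≈ (cong (n' *_) (toℕ-fromℕ< n'<n))) n'*n'≈1)

  rotate-zero : rotate fzero ≡ fzero
  rotate-zero = rotate-lower fzero (s≤s z≤n)

  top≡ : ∀ {F : Fin n} → toℕ F ≡ n' → F ≡ top
  top≡ e = toℕ-injective (trans e (sym (toℕ-fromℕ< n'<n)))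

  C₂ : Permutation′ n
  C₂ = interleave ∘ₚ transpose fzero top ∘ₚ negate

  blockSum-C₂-zero : blockSum C₂ fzero ≈ 1
  blockSum-C₂-zero = ≈-trans (≡⇒≈ (begin
    0 + toℕ (rotate fzero) + toℕ (negate ⟨$⟩ʳ (transpose fzero top ⟨$⟩ʳ (interleave ⟨$⟩ʳ fzero)))
      ≡⟨ cong₂ (λ a b → toℕ a + toℕ (negate ⟨$⟩ʳ (transpose fzero top ⟨$⟩ʳ b))) rotate-zero interleave-zero ⟩
    toℕ (negate ⟨$⟩ʳ (transpose fzero top ⟨$⟩ʳ fzero))
      ≡⟨ cong (λ b → toℕ (negate ⟨$⟩ʳ b)) (transpose-left fzero top) ⟩
    toℕ (negate ⟨$⟩ʳ top) ∎)) negate-top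
    where open ≡-Reasoning

  blockSum-C₂-inner : ∀ F → 0 < toℕ F → toℕ F < n' → blockSum C₂ F ≈ 0
  blockSum-C₂-inner F 0<F F<n' = block-cancels C₂ F F<n'
    (cong (negate ⟨$⟩ʳ_) (transpose-other fzero top (interleave ⟨$⟩ʳ F)
      (λ e → <⇒≢ 0<F (sym (cong toℕ (interleave-injective (trans e (sym interleave-zero))))))
      (λ e → <⇒≢ F<n' (trans (cong toℕ (interleave-injective (trans e (sym interleave-top)))) (toℕ-fromℕ< n'<n)))))

  blockSum-C₂-top : blockSum C₂ top ≈ m'
  blockSum-C₂-top = ≈-by 0 1 (begin
    toℕ top + toℕ (rotate top) + toℕ (negate ⟨$⟩ʳ (transpose fzero top ⟨$⟩ʳ (interleave ⟨$⟩ʳ top))) + 0 * n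
      ≡⟨ cong (λ b → toℕ top + toℕ (rotate top) + toℕ (negate ⟨$⟩ʳ (transpose fzero top ⟨$⟩ʳ b)) + 0 * n) interleave-top ⟩
    toℕ top + toℕ (rotate top) + toℕ (negate ⟨$⟩ʳ (transpose fzero top ⟨$⟩ʳ top)) + 0 * n
      ≡⟨ cong (λ b → toℕ top + toℕ (rotate top) + toℕ (negate ⟨$⟩ʳ b) + 0 * n) (transpose-right fzero top) ⟩
    toℕ top + toℕ (rotate top) + toℕ (negate ⟨$⟩ʳ fzero) + 0 * n
      ≡⟨ cong₃ (toℕ-fromℕ< n'<n) (rotate-top top (toℕ-fromℕ< n'<n)) (cong toℕ negate-zero) ⟩
    n' + m + 0 + 0 * n
      ≡⟨ wrap m' ⟩
    m' + 1 * n ∎)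
    where
      open ≡-Reasoning
      cong₃ : ∀ {a b c a' b' c'} → a ≡ a' → b ≡ b' → c ≡ c' → a + b + c + 0 * n ≡ a' + b' + c' + 0 * n
      cong₃ refl refl refl = refl
      wrap : ∀ m' → (m' + suc m') + suc m' + 0 + 0 * suc (m' + suc m') ≡ m' + 1 * suc (m' + suc m')
      wrap = solve-∀

  module ThreeLayer (o k : ℕ) (o+2k≤n : o + k * 2 ≤ n) (κ C : Permutation′ n) where
    open PairFlip o k o+2k≤n

    layers : Design n
    layers = ((flipPairs ∘ₚ κ) ∷ (κ ∘ₚ rotateUpper) ∷ (κ ∘ₚ C) ∷ []) then-alternating

    relation : ∀ K f → shift layers f (3 + K * 2) + toℕ (κ ⟨$⟩ʳ f) ≈ toℕ (κ ⟨$⟩ʳ flip f) + blockSum C (κ ⟨$⟩ʳ f)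
    relation K f = ≈-trans (+ʳ-≈ (toℕ (κ ⟨$⟩ʳ f)) (alternating-cancels (flipPairs ∘ₚ κ ∷ κ ∘ₚ rotateUpper ∷ κ ∘ₚ C ∷ []) f K))
                           (≡⇒≈ (rearrange (toℕ (κ ⟨$⟩ʳ flip f)) (toℕ (rotate (κ ⟨$⟩ʳ f))) (toℕ (C ⟨$⟩ʳ (κ ⟨$⟩ʳ f))) (toℕ (κ ⟨$⟩ʳ f))))
      where
        rearrange : ∀ a b c l → 0 + a + b + c + l ≡ a + (l + b + c)
        rearrange = solve-∀

module Blocks₃ (m'' : ℕ) where
  open Blocks (suc m'') public
  open Modular n

  one : Fin n
  one = fsuc fzero

  one≢top : one ≢ top
  one≢top e = <⇒≢ (s≤s (≤-trans (s≤s z≤n) (m≤n+m m m''))) (trans (cong toℕ e) (toℕ-fromℕ< n'<n))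

  zero≢top : fzero ≢ top
  zero≢top e = <⇒≢ (s≤s z≤n) (trans (cong toℕ e) (toℕ-fromℕ< n'<n))

  C₃ : Permutation′ n
  C₃ = interleave ∘ₚ transpose one top ∘ₚ transpose fzero top ∘ₚ negate

  blockSum-C₃-zero : blockSum C₃ fzero ≈ 1
  blockSum-C₃-zero = ≈-trans (≡⇒≈ (begin
    0 + toℕ (rotate fzero) + toℕ (negate ⟨$⟩ʳ (transpose fzero top ⟨$⟩ʳ (transpose one top ⟨$⟩ʳ (interleave ⟨$⟩ʳ fzero))))
      ≡⟨ cong₂ (λ a b → toℕ a + toℕ (negate ⟨$⟩ʳ (transpose fzero top ⟨$⟩ʳ (transpose one top ⟨$⟩ʳ b)))) rotate-zero interleave-zero ⟩
    toℕ (negate ⟨$⟩ʳ (transpose fzero top ⟨$⟩ʳ (transpose one top ⟨$⟩ʳ fzero)))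
      ≡⟨ cong (λ b → toℕ (negate ⟨$⟩ʳ (transpose fzero top ⟨$⟩ʳ b))) (transpose-other one top fzero (λ ()) zero≢top) ⟩
    toℕ (negate ⟨$⟩ʳ (transpose fzero top ⟨$⟩ʳ fzero))
      ≡⟨ cong (λ b → toℕ (negate ⟨$⟩ʳ b)) (transpose-left fzero top) ⟩
    toℕ (negate ⟨$⟩ʳ top) ∎)) negate-top
    where open ≡-Reasoning

  blockSum-C₃-mid : blockSum C₃ mid ≈ 1
  blockSum-C₃-mid = ≈-by 0 1 (begin
    toℕ mid + toℕ (rotate mid) + toℕ (negate ⟨$⟩ʳ (transpose fzero top ⟨$⟩ʳ (transpose one top ⟨$⟩ʳ (interleave ⟨$⟩ʳ mid))))
      + 0 * n
      ≡⟨ cong (λ b → toℕ mid + toℕ (rotate mid) + toℕ (negate ⟨$⟩ʳ (transpose fzero top ⟨$⟩ʳ (transpose one top ⟨$⟩ʳ b))) + 0 * n)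
              (toℕ-injective interleave-mid) ⟩
    toℕ mid + toℕ (rotate mid) + toℕ (negate ⟨$⟩ʳ (transpose fzero top ⟨$⟩ʳ (transpose one top ⟨$⟩ʳ one))) + 0 * n
      ≡⟨ cong (λ b → toℕ mid + toℕ (rotate mid) + toℕ (negate ⟨$⟩ʳ (transpose fzero top ⟨$⟩ʳ b)) + 0 * n) (transpose-left one top) ⟩
    toℕ mid + toℕ (rotate mid) + toℕ (negate ⟨$⟩ʳ (transpose fzero top ⟨$⟩ʳ top)) + 0 * n
      ≡⟨ cong (λ b → toℕ mid + toℕ (rotate mid) + toℕ (negate ⟨$⟩ʳ b) + 0 * n) (transpose-right fzero top) ⟩
    toℕ mid + toℕ (rotate mid) + toℕ (negate ⟨$⟩ʳ fzero) + 0 * n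
      ≡⟨ cong₂ (λ a b → toℕ mid + a + toℕ b + 0 * n) (rotate-middle mid (≤-reflexive (sym mid≡)) (subst (λ z → suc z < n) (sym mid≡) m+1<n)) negate-zero ⟩
    toℕ mid + suc (toℕ mid) + 0 + 0 * n
      ≡⟨ cong (λ z → z + suc z + 0 + 0 * n) mid≡ ⟩
    m + suc m + 0 + 0 * n
      ≡⟨ wrap m'' ⟩
    1 + 1 * n ∎)
    where
      open ≡-Reasoning
      mid≡ : toℕ mid ≡ m
      mid≡ = toℕ-fromℕ< m<n
      m+1<n : suc m < n
      m+1<n = s≤s (s≤s (m≤n+m _ m''))
      wrap : ∀ m'' → suc (suc m'') + suc (suc (suc m'')) + 0 + 0 * suc (suc m'' + suc (suc m''))
                     ≡ 1 + 1 * suc (suc m'' + suc (suc m''))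
      wrap = solve-∀

  blockSum-C₃-top : blockSum C₃ top ≈ m''
  blockSum-C₃-top = begin
    toℕ top + toℕ (rotate top) + toℕ (negate ⟨$⟩ʳ (transpose fzero top ⟨$⟩ʳ (transpose one top ⟨$⟩ʳ (interleave ⟨$⟩ʳ top))))
      ≡⟨ cong (λ b → toℕ top + toℕ (rotate top) + toℕ (negate ⟨$⟩ʳ (transpose fzero top ⟨$⟩ʳ (transpose one top ⟨$⟩ʳ b)))) interleave-top ⟩
    toℕ top + toℕ (rotate top) + toℕ (negate ⟨$⟩ʳ (transpose fzero top ⟨$⟩ʳ (transpose one top ⟨$⟩ʳ top)))
      ≡⟨ cong (λ b → toℕ top + toℕ (rotate top) + toℕ (negate ⟨$⟩ʳ (transpose fzero top ⟨$⟩ʳ b))) (transpose-right one top) ⟩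
    toℕ top + toℕ (rotate top) + toℕ (negate ⟨$⟩ʳ (transpose fzero top ⟨$⟩ʳ one))
      ≡⟨ cong (λ b → toℕ top + toℕ (rotate top) + toℕ (negate ⟨$⟩ʳ b)) (transpose-other fzero top one (λ ()) one≢top) ⟩
    toℕ top + toℕ (rotate top) + toℕ (negate ⟨$⟩ʳ one)
      ≡⟨ cong₂ (λ a b → a + b + toℕ (negate ⟨$⟩ʳ one)) (toℕ-fromℕ< n'<n) (rotate-top top (toℕ-fromℕ< n'<n)) ⟩
    n' + m + toℕ (negate ⟨$⟩ʳ one)
      ≈⟨ +ˡ-≈ (n' + m) (≈-trans (negate-≈ one) (≡⇒≈ (*-identityʳ n'))) ⟩
    n' + m + n'
      ≈⟨ ≈-by 0 2 (wrap m'') ⟩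
    m'' ∎
    where
      open ≈-Reasoning
      wrap : ∀ m'' → (suc m'' + suc (suc m'')) + suc (suc m'') + (suc m'' + suc (suc m'')) + 0 * suc (suc m'' + suc (suc m''))
                     ≡ m'' + 2 * suc (suc m'' + suc (suc m''))
      wrap = solve-∀

  blockSum-C₃-inner : ∀ F → 0 < toℕ F → toℕ F < n' → F ≢ mid → blockSum C₃ F ≈ 0
  blockSum-C₃-inner F 0<F F<n' F≢mid = block-cancels C₃ F F<n' (cong (negate ⟨$⟩ʳ_) (begin
      transpose fzero top ⟨$⟩ʳ (transpose one top ⟨$⟩ʳ ψF) ≡⟨ cong (transpose fzero top ⟨$⟩ʳ_) (transpose-other one top ψF ψF≢one ψF≢top) ⟩
      transpose fzero top ⟨$⟩ʳ ψF                         ≡⟨ transpose-other fzero top ψF ψF≢zero ψF≢top ⟩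
      ψF                                                  ∎))
    where
      open ≡-Reasoning
      ψF = interleave ⟨$⟩ʳ F
      ψF≢zero : ψF ≢ fzero
      ψF≢zero e = <⇒≢ 0<F (sym (cong toℕ (interleave-injective (trans e (sym interleave-zero)))))
      ψF≢top : ψF ≢ top
      ψF≢top e = <⇒≢ F<n' (trans (cong toℕ (interleave-injective (trans e (sym interleave-top)))) (toℕ-fromℕ< n'<n))
      ψF≢one : ψF ≢ one
      ψF≢one e = F≢mid (interleave-injective (trans e (sym (toℕ-injective interleave-mid))))

-- M = 2 + 2K even, β = 2k: layers flipPairs, negate, then alternating.  The total
-- shift of f is flip f - f, i.e. ±1 on the first 2k labels and 0 beyond.
module EvenDesign (n' K k α : ℕ) (M≥3 : 3 ≤ 2 + K * 2) (2k+α≡n : k * 2 + α ≡ suc n') where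
  open Alternating n'
  open Modular n
  private
    2k≤n = subst (k * 2 ≤_) 2k+α≡n (m≤m+n (k * 2) α)
  open PairFlip 0 k 2k≤n

  layers : Design n
  layers = (flipPairs ∷ negate ∷ []) then-alternating

  relation : ∀ f → shift layers f (2 + K * 2) + toℕ f ≈ toℕ (flip f) + 0
  relation f = begin
    shift layers f (2 + K * 2) + toℕ f                   ≈⟨ +ʳ-≈ (toℕ f) (alternating-cancels (flipPairs ∷ negate ∷ []) f K) ⟩
    toℕ (flip f) + toℕ (negate ⟨$⟩ʳ f) + toℕ f          ≡⟨ +-assoc (toℕ (flip f)) _ _ ⟩
    toℕ (flip f) + (toℕ (negate ⟨$⟩ʳ f) + toℕ f)        ≡⟨ cong (toℕ (flip f) +_) (+-comm _ (toℕ f)) ⟩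
    toℕ (flip f) + (toℕ f + toℕ (negate ⟨$⟩ʳ f))        ≈⟨ +ˡ-≈ (toℕ (flip f)) (+negate≈0 f) ⟩
    toℕ (flip f) + 0                                     ∎
    where open ≈-Reasoning

  open FlipShifts n' 0 k 2k≤n (λ f → shift layers f (2 + K * 2)) toℕ (λ _ → 0)
         relation (λ _ _ → ≈-refl) (λ f g j _ g≡ → g≡)

  hwp : HWP (C[ 2 + K * 2 ] n) (2 + K * 2) ((2 + K * 2) * n) α (k * 2)
  hwp = LayeredFactors.Partition.hwp (suc (K * 2)) n' M≥3 layers α (k * 2) 2k+α≡n
          above-zero (λ f f<2k → inside-unit f z≤n f<2k)

-- n = 2, M = 3 + 2K, β = 1: the three-layer design with κ = id, C = C₂ and no
-- flipped pairs.  Label 0 has shift blockSum C₂ 0 ≡ 1 and label 1 has shift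
-- blockSum C₂ 1 ≡ m - 1 = 0.
module TwoDesign (K : ℕ) where
  open Blocks 0
  open Modular n
  open ThreeLayer 2 0 ≤-refl Perm.id C₂

  open FlipShifts 1 2 0 ≤-refl (λ f → shift layers f (3 + K * 2)) (λ f → toℕ (Perm.id ⟨$⟩ʳ f))
         (λ f → blockSum C₂ (Perm.id ⟨$⟩ʳ f)) (relation K)
         (λ f 2≤f → ⊥-elim (<⇒≱ (toℕ<n f) 2≤f))
         (λ f g j f≡ _ → ⊥-elim (<⇒≱ (toℕ<n f) (subst (2 ≤_) (sym f≡) (m≤m+n 2 (j * 2)))))

  zero-shifts : ∀ f → 1 ≤ toℕ f → shift layers f (3 + K * 2) ≈ 0
  zero-shifts (fsuc fzero) _ = ≈-trans (below-shift top (s≤s (s≤s z≤n))) blockSum-C₂-top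

  unit-shifts : ∀ f → toℕ f < 1 → IsUnit (shift layers f (3 + K * 2))
  unit-shifts fzero _ = ≈1-unit (≈-trans (below-shift fzero (s≤s z≤n)) blockSum-C₂-zero)
  unit-shifts (fsuc _) (s≤s ())

  hwp : HWP (C[ 3 + K * 2 ] 2) (3 + K * 2) ((3 + K * 2) * 2) 1 1
  hwp = LayeredFactors.Partition.hwp (2 + K * 2) 1 (s≤s (s≤s (s≤s z≤n))) layers 1 1 refl zero-shifts unit-shifts

-- n = 2m with m = 2j + 2 even, M = 3 + 2K, β = 2 + 2k: the three-layer design with
-- κ = (x ↦ x - 1), C = C₂ and pairs flipped from label 2 on.  Labels 0 and 1 have
-- shifts blockSum C₂ top ≡ m - 1 and blockSum C₂ 0 ≡ 1, both units.
module EvenHalfDesign (j K k α : ℕ) (β+α≡n : (2 + k * 2) + α ≡ suc (suc (j * 2)) + suc (suc (j * 2))) where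
  open Blocks (suc (j * 2))
  open Modular n
  private
    β≤n = subst (2 + k * 2 ≤_) β+α≡n (m≤m+n (2 + k * 2) α)
  κ : Permutation′ n
  κ = translate n'

  open ThreeLayer 2 k β≤n κ C₂

  κ-zero : κ ⟨$⟩ʳ fzero ≡ top
  κ-zero = top≡ (translate-wrap 1 fzero (s≤s z≤n) (s≤s z≤n))

  κ-pos : ∀ x → 1 ≤ toℕ x → toℕ (κ ⟨$⟩ʳ x) ≡ toℕ x ∸ 1
  κ-pos x 1≤x = translate-down 1 x (s≤s z≤n) 1≤x

  κ-one : κ ⟨$⟩ʳ fsuc fzero ≡ fzero
  κ-one = toℕ-injective {i = κ ⟨$⟩ʳ fsuc fzero} {j = fzero} (κ-pos (fsuc fzero) (s≤s z≤n))

  -- from label 2 on, κ avoids the exceptional points 0 and top of C₂ …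
  B-vanishes : ∀ f → 2 ≤ toℕ f → blockSum C₂ (κ ⟨$⟩ʳ f) ≈ 0
  B-vanishes f 2≤f = blockSum-C₂-inner (κ ⟨$⟩ʳ f)
    (subst (0 <_) (sym (κ-pos f 1≤f)) (∸-monoˡ-≤ 1 2≤f))
    (subst (_< n') (sym (κ-pos f 1≤f)) (∸-monoˡ-< (toℕ<n f) 1≤f))
    where 1≤f = ≤-trans (s≤s z≤n) 2≤f

  consecutive : ∀ f g i → toℕ f ≡ 2 + i * 2 → toℕ g ≡ suc (toℕ f) → toℕ (κ ⟨$⟩ʳ g) ≡ suc (toℕ (κ ⟨$⟩ʳ f))
  consecutive f g i f≡ g≡ = begin
    toℕ (κ ⟨$⟩ʳ g)       ≡⟨ κ-pos g (subst (1 ≤_) (sym g≡) (s≤s z≤n)) ⟩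
    toℕ g ∸ 1            ≡⟨ cong (_∸ 1) g≡ ⟩
    toℕ f                ≡⟨ m∸n+n≡m 1≤f ⟨
    toℕ f ∸ 1 + 1        ≡⟨ +-comm (toℕ f ∸ 1) 1 ⟩
    suc (toℕ f ∸ 1)      ≡⟨ cong suc (κ-pos f 1≤f) ⟨
    suc (toℕ (κ ⟨$⟩ʳ f)) ∎
    where
      open ≡-Reasoning
      1≤f = subst (1 ≤_) (sym f≡) (s≤s z≤n)

  S : Fin n → ℕ
  S f = shift layers f (3 + K * 2)

  open FlipShifts n' 2 k β≤n S (λ f → toℕ (κ ⟨$⟩ʳ f)) (λ f → blockSum C₂ (κ ⟨$⟩ʳ f)) (relation K) B-vanishes consecutive

  m' : ℕ
  m' = suc (j * 2)

  m'*m'≈1 : m' * m' ≈ 1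
  m'*m'≈1 = ≈-by 0 j (square j)
    where
      square : ∀ j → suc (j * 2) * suc (j * 2) + 0 * suc (suc (j * 2) + suc (suc (j * 2))) ≡ 1 + j * suc (suc (j * 2) + suc (suc (j * 2)))
      square = solve-∀

  base-unit : ∀ f → toℕ f < 2 → IsUnit (S f)
  base-unit fzero f<2 = m' , (begin
    S fzero * m'                  ≈⟨ *ʳ-≈ m' (below-shift fzero f<2) ⟩
    blockSum C₂ (κ ⟨$⟩ʳ fzero) * m' ≡⟨ cong (λ F → blockSum C₂ F * m') κ-zero ⟩
    blockSum C₂ top * m'          ≈⟨ *ʳ-≈ m' blockSum-C₂-top ⟩
    m' * m'                       ≈⟨ m'*m'≈1 ⟩
    1                             ∎)
    where open ≈-Reasoning
  base-unit (fsuc fzero) f<2 = ≈1-unit (begin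
    S (fsuc fzero)                    ≈⟨ below-shift (fsuc fzero) f<2 ⟩
    blockSum C₂ (κ ⟨$⟩ʳ fsuc fzero)   ≡⟨ cong (blockSum C₂) κ-one ⟩
    blockSum C₂ fzero                 ≈⟨ blockSum-C₂-zero ⟩
    1                                 ∎)
    where open ≈-Reasoning
  base-unit (fsuc (fsuc _)) (s≤s (s≤s ()))

  unit-shifts : ∀ f → toℕ f < 2 + k * 2 → IsUnit (S f)
  unit-shifts f f<β = by-cases (toℕ f <? 2)
    where
      by-cases : Dec (toℕ f < 2) → IsUnit (S f)
      by-cases (yes f<2) = base-unit f f<2
      by-cases (no 2≰f)  = inside-unit f (≮⇒≥ 2≰f) f<β

  hwp : HWP (C[ 3 + K * 2 ] n) (3 + K * 2) ((3 + K * 2) * n) α (2 + k * 2)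
  hwp = LayeredFactors.Partition.hwp (2 + K * 2) n' (s≤s (s≤s (s≤s z≤n))) layers α (2 + k * 2) β+α≡n
          above-zero unit-shifts

-- n = 2m with m = 2h + 3 odd, M = 3 + 2K, β = 3 + 2k: the three-layer design with
-- κ = (0 top) ∘ rotateUpper ∘ (x ↦ x - 2), C = C₃ and pairs flipped from label 3 on.
-- κ sends the labels 0, 1, 2 to the exceptional points 0, m, top of C₃, whose block
-- sums 1, 1, m - 2 are units, and maps [3, n) monotonically onto the other points.
module OddHalfDesign (h K k α : ℕ) (β+α≡n : (3 + k * 2) + α ≡ suc (suc (suc (h * 2))) + suc (suc (suc (h * 2)))) where
  m'' = suc (h * 2)
  open Blocks₃ m''
  open Modular n
  private
    β≤n = subst (3 + k * 2 ≤_) β+α≡n (m≤m+n (3 + k * 2) α)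

  m''-unit : IsUnit m''
  m''-unit with parity h
  ... | inj₁ (g , refl) = suc (g * 2) , ≈-by 0 g (inverse g)
    where
      inverse : ∀ g → suc (g * 2 * 2) * suc (g * 2) + 0 * suc (suc (suc (g * 2 * 2)) + suc (suc (suc (g * 2 * 2))))
                      ≡ 1 + g * suc (suc (suc (g * 2 * 2)) + suc (suc (suc (g * 2 * 2))))
      inverse = solve-∀
  ... | inj₂ (g , refl) = 7 + g * 6 , ≈-by 0 (2 + g * 3) (inverse g)
    where
      inverse : ∀ g → suc ((1 + g * 2) * 2) * (7 + g * 6) + 0 * suc (suc (suc ((1 + g * 2) * 2)) + suc (suc (suc ((1 + g * 2) * 2))))
                      ≡ 1 + (2 + g * 3) * suc (suc (suc ((1 + g * 2) * 2)) + suc (suc (suc ((1 + g * 2) * 2))))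
      inverse = solve-∀

  T : Fin n → Fin n
  T x = translate (n ∸ 2) ⟨$⟩ʳ x

  κ : Permutation′ n
  κ = translate (n ∸ 2) ∘ₚ rotateUpper ∘ₚ transpose fzero top

  2≤n : 2 ≤ n
  2≤n = s≤s (s≤s z≤n)

  transpose-fixes : ∀ y → 0 < toℕ y → toℕ y < n' → transpose fzero top ⟨$⟩ʳ y ≡ y
  transpose-fixes y 0<y y<n' = transpose-other fzero top y
    (λ e → <⇒≢ 0<y (sym (cong toℕ e)))
    (λ e → <⇒≢ y<n' (trans (cong toℕ e) (toℕ-fromℕ< n'<n)))

  κ-zero : κ ⟨$⟩ʳ fzero ≡ fzero
  κ-zero = trans (cong (transpose fzero top ⟨$⟩ʳ_) (top≡ rotated)) (transpose-right fzero top)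
    where
      T0 : toℕ (T fzero) ≡ n ∸ 2
      T0 = translate-wrap 2 fzero 2≤n (s≤s z≤n)
      rotated : toℕ (rotate (T fzero)) ≡ n'
      rotated = trans (rotate-middle (T fzero) (subst (m ≤_) (sym T0) (m≤n+m m m''))
                                      (subst (λ z → suc z < n) (sym T0) (n<1+n n')))
                      (cong suc T0)

  κ-one : κ ⟨$⟩ʳ fsuc fzero ≡ mid
  κ-one = toℕ-injective {i = κ ⟨$⟩ʳ fsuc fzero} {j = mid}
    (trans (cong toℕ (transpose-fixes (rotate (T (fsuc fzero)))
             (subst (0 <_) (sym rotated) (s≤s z≤n)) (subst (_< n') (sym rotated) (s≤s (m≤n+m m m'')))))
           (trans rotated (sym (toℕ-fromℕ< m<n))))
    where
      rotated : toℕ (rotate (T (fsuc fzero))) ≡ m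
      rotated = rotate-top (T (fsuc fzero)) (translate-wrap 2 (fsuc fzero) 2≤n (s≤s (s≤s z≤n)))

  κ-two : κ ⟨$⟩ʳ fsuc (fsuc fzero) ≡ top
  κ-two = trans (cong (λ y → transpose fzero top ⟨$⟩ʳ rotate y) T2) (trans (cong (transpose fzero top ⟨$⟩ʳ_) rotate-zero) (transpose-left fzero top))
    where
      T2 : T (fsuc (fsuc fzero)) ≡ fzero
      T2 = toℕ-injective {i = T (fsuc (fsuc fzero))} {j = fzero} (translate-down 2 (fsuc (fsuc fzero)) 2≤n ≤-refl)

  κ-low : ∀ x → 3 ≤ toℕ x → toℕ x ≤ suc m → toℕ (κ ⟨$⟩ʳ x) ≡ toℕ x ∸ 2
  κ-low x 3≤x x≤m+1 = trans (cong toℕ (transpose-fixes (rotate (T x)) 0<y y<n')) y≡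
    where
      Tx = translate-down 2 x 2≤n (≤-trans (n≤1+n 2) 3≤x)
      Tx<m : toℕ (T x) < m
      Tx<m = subst (_< m) (sym Tx) (≤-trans (≤-reflexive (sym (+-∸-assoc 1 (≤-trans (n≤1+n 2) 3≤x)))) (∸-monoˡ-≤ 2 (s≤s x≤m+1)))
      y≡ : toℕ (rotate (T x)) ≡ toℕ x ∸ 2
      y≡ = trans (cong toℕ (rotate-lower (T x) Tx<m)) Tx
      0<y : 0 < toℕ (rotate (T x))
      0<y = subst (0 <_) (sym y≡) (∸-monoˡ-≤ 2 3≤x)
      y<n' : toℕ (rotate (T x)) < n'
      y<n' = subst (_< n') (sym (trans (cong toℕ (rotate-lower (T x) Tx<m)) refl)) (<-≤-trans Tx<m (m≤n+m m (suc m'')))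

  κ-high : ∀ x → suc (suc m) ≤ toℕ x → toℕ (κ ⟨$⟩ʳ x) ≡ toℕ x ∸ 1
  κ-high x m+2≤x = trans (cong toℕ (transpose-fixes (rotate (T x)) 0<y y<n')) y≡
    where
      2≤x = ≤-trans (s≤s (s≤s z≤n)) m+2≤x
      Tx = translate-down 2 x 2≤n 2≤x
      m≤Tx : m ≤ toℕ (T x)
      m≤Tx = subst (m ≤_) (sym Tx) (subst (_≤ toℕ x ∸ 2) (m+n∸m≡n 2 m) (∸-monoˡ-≤ 2 m+2≤x))
      Tx+1<n : suc (toℕ (T x)) < n
      Tx+1<n = subst (λ z → suc z < n) (sym Tx) (≤-<-trans (≤-reflexive (sym (+-∸-assoc 1 2≤x))) (≤-<-trans (m∸n≤m _ 1) (toℕ<n x)))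
      y≡ : toℕ (rotate (T x)) ≡ toℕ x ∸ 1
      y≡ = trans (rotate-middle (T x) m≤Tx Tx+1<n) (trans (cong suc Tx) (sym (+-∸-assoc 1 2≤x)))
      0<y : 0 < toℕ (rotate (T x))
      0<y = subst (0 <_) (sym (rotate-middle (T x) m≤Tx Tx+1<n)) (s≤s z≤n)
      y<n' : toℕ (rotate (T x)) < n'
      y<n' = subst (_< n') (sym y≡) (∸-monoˡ-< (toℕ<n x) (≤-trans (s≤s z≤n) m+2≤x))

  -- from label 3 on, κ avoids the exceptional points 0, mid, top of C₃ …
  low-vanishes : ∀ f → 3 ≤ toℕ f → toℕ f ≤ suc m → blockSum C₃ (κ ⟨$⟩ʳ f) ≈ 0
  low-vanishes f 3≤f f≤m+1 = blockSum-C₃-inner (κ ⟨$⟩ʳ f) (subst (0 <_) (sym κf≡) (∸-monoˡ-≤ 2 3≤f))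
                      (subst (_< n') (sym κf≡) (<-≤-trans κf<m' (m≤n+m m (suc m''))))
                      (λ e → <⇒≢ κf<m (trans (cong toℕ e) (toℕ-fromℕ< m<n)))
    where
      κf≡ = κ-low f 3≤f f≤m+1
      κf<m' : toℕ f ∸ 2 < m
      κf<m' = ≤-trans (≤-reflexive (sym (+-∸-assoc 1 (≤-trans (n≤1+n 2) 3≤f)))) (∸-monoˡ-≤ 2 (s≤s f≤m+1))
      κf<m : toℕ (κ ⟨$⟩ʳ f) < m
      κf<m = subst (_< m) (sym κf≡) κf<m'

  high-vanishes : ∀ f → suc (suc m) ≤ toℕ f → blockSum C₃ (κ ⟨$⟩ʳ f) ≈ 0
  high-vanishes f m+2≤f = blockSum-C₃-inner (κ ⟨$⟩ʳ f) (<-trans (s≤s z≤n) m<κf)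
                      (subst (_< n') (sym κf≡) (∸-monoˡ-< (toℕ<n f) (≤-trans (s≤s z≤n) m+2≤f)))
                      (λ e → <⇒≢ m<κf (sym (trans (cong toℕ e) (toℕ-fromℕ< m<n))))
    where
      κf≡ = κ-high f m+2≤f
      m<κf : m < toℕ (κ ⟨$⟩ʳ f)
      m<κf = subst (m <_) (sym κf≡) (subst (_≤ toℕ f ∸ 1) (m+n∸m≡n 1 (suc m)) (∸-monoˡ-≤ 1 m+2≤f))

  B-vanishes : ∀ f → 3 ≤ toℕ f → blockSum C₃ (κ ⟨$⟩ʳ f) ≈ 0
  B-vanishes f 3≤f = by-cases (toℕ f ≤? suc m)
    where
      by-cases : Dec (toℕ f ≤ suc m) → blockSum C₃ (κ ⟨$⟩ʳ f) ≈ 0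
      by-cases (yes f≤m+1) = low-vanishes f 3≤f f≤m+1
      by-cases (no f≰m+1)  = high-vanishes f (≰⇒> f≰m+1)

  -- … and keeps the flipped pairs consecutive: the pair (3 + 2i , 4 + 2i) never
  -- straddles the jump of κ between m + 1 and m + 2, since m + 1 is even
  consecutive : ∀ f g i → toℕ f ≡ 3 + i * 2 → toℕ g ≡ suc (toℕ f) → toℕ (κ ⟨$⟩ʳ g) ≡ suc (toℕ (κ ⟨$⟩ʳ f))
  consecutive f g i f≡ g≡ with toℕ f ≤? m
  ... | yes f≤m = begin
        toℕ (κ ⟨$⟩ʳ g) ≡⟨ κ-low g (≤-trans 3≤f (≤-trans (n≤1+n _) (≤-reflexive (sym g≡)))) (≤-trans (≤-reflexive g≡) (s≤s f≤m)) ⟩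
        toℕ g ∸ 2      ≡⟨ cong (_∸ 2) g≡ ⟩
        suc (toℕ f) ∸ 2 ≡⟨ +-∸-assoc 1 (≤-trans (n≤1+n 2) 3≤f) ⟩
        suc (toℕ f ∸ 2) ≡⟨ cong suc (κ-low f 3≤f (≤-trans f≤m (n≤1+n m))) ⟨
        suc (toℕ (κ ⟨$⟩ʳ f)) ∎
    where
      open ≡-Reasoning
      3≤f = subst (3 ≤_) (sym f≡) (m≤m+n 3 (i * 2))
  ... | no f≰m = begin
        toℕ (κ ⟨$⟩ʳ g) ≡⟨ κ-high g (≤-trans m+2≤f (≤-trans (n≤1+n _) (≤-reflexive (sym g≡)))) ⟩
        toℕ g ∸ 1      ≡⟨ cong (_∸ 1) g≡ ⟩
        toℕ f          ≡⟨ +-∸-assoc 1 1≤f ⟩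
        suc (toℕ f ∸ 1) ≡⟨ cong suc (κ-high f m+2≤f) ⟨
        suc (toℕ (κ ⟨$⟩ʳ f)) ∎
    where
      open ≡-Reasoning
      1≤f = subst (1 ≤_) (sym f≡) (s≤s z≤n)
      f≢m+1 : toℕ f ≢ suc m
      f≢m+1 e = even≢odd (2 + h) (1 + i) (begin
        2 * (2 + h)     ≡⟨ double (2 + h) ⟩
        suc m           ≡⟨ e ⟨
        toℕ f           ≡⟨ f≡ ⟩
        3 + i * 2       ≡⟨ cong suc (double (1 + i)) ⟨
        suc (2 * (1 + i)) ∎)
        where
          double : ∀ a → 2 * a ≡ a * 2
          double a = *-comm 2 a
      m+2≤f : suc (suc m) ≤ toℕ f
      m+2≤f = ≤∧≢⇒< (≰⇒> f≰m) (λ e → f≢m+1 (sym e))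

  open ThreeLayer 3 k β≤n κ C₃

  S : Fin n → ℕ
  S f = shift layers f (3 + K * 2)

  open FlipShifts n' 3 k β≤n S (λ f → toℕ (κ ⟨$⟩ʳ f)) (λ f → blockSum C₃ (κ ⟨$⟩ʳ f)) (relation K) B-vanishes consecutive

  base-unit : ∀ f → toℕ f < 3 → IsUnit (S f)
  base-unit fzero f<3 = ≈1-unit (begin
    S fzero                      ≈⟨ below-shift fzero f<3 ⟩
    blockSum C₃ (κ ⟨$⟩ʳ fzero)   ≡⟨ cong (blockSum C₃) κ-zero ⟩
    blockSum C₃ fzero            ≈⟨ blockSum-C₃-zero ⟩
    1                            ∎)
    where open ≈-Reasoning
  base-unit (fsuc fzero) f<3 = ≈1-unit (begin
    S (fsuc fzero)                  ≈⟨ below-shift (fsuc fzero) f<3 ⟩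
    blockSum C₃ (κ ⟨$⟩ʳ fsuc fzero) ≡⟨ cong (blockSum C₃) κ-one ⟩
    blockSum C₃ mid                 ≈⟨ blockSum-C₃-mid ⟩
    1                               ∎)
    where open ≈-Reasoning
  base-unit (fsuc (fsuc fzero)) f<3 = t , (begin
    S (fsuc (fsuc fzero)) * t                  ≈⟨ *ʳ-≈ t (below-shift (fsuc (fsuc fzero)) f<3) ⟩
    blockSum C₃ (κ ⟨$⟩ʳ fsuc (fsuc fzero)) * t ≡⟨ cong (λ F → blockSum C₃ F * t) κ-two ⟩
    blockSum C₃ top * t                        ≈⟨ *ʳ-≈ t blockSum-C₃-top ⟩
    m'' * t                                    ≈⟨ proj₂ m''-unit ⟩
    1                                          ∎)
    where
      open ≈-Reasoning
      t = proj₁ m''-unit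
  base-unit (fsuc (fsuc (fsuc _))) (s≤s (s≤s (s≤s ())))

  unit-shifts : ∀ f → toℕ f < 3 + k * 2 → IsUnit (S f)
  unit-shifts f f<β = by-cases (toℕ f <? 3)
    where
      by-cases : Dec (toℕ f < 3) → IsUnit (S f)
      by-cases (yes f<3) = base-unit f f<3
      by-cases (no 3≰f)  = inside-unit f (≮⇒≥ 3≰f) f<β

  hwp : HWP (C[ 3 + K * 2 ] n) (3 + K * 2) ((3 + K * 2) * n) α (3 + k * 2)
  hwp = LayeredFactors.Partition.hwp (2 + K * 2) n' (s≤s (s≤s (s≤s z≤n))) layers α (3 + k * 2) β+α≡n
          above-zero unit-shifts

half-product : ∀ M m → (M * (m + m)) / 2 ≡ M * m
half-product M m = trans (cong (_/ 2) (double M m)) (m*n/n≡m (M * m) 2)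
  where
    double : ∀ M m → M * (m + m) ≡ M * m * 2
    double = solve-∀

even%2 : ∀ g → (g * 2) % 2 ≡ 0
even%2 g = m*n%n≡0 g 2

odd%2 : ∀ g → (1 + g * 2) % 2 ≡ 1
odd%2 g = [m+kn]%n≡m%n 1 g 2

even-M-half : ∀ K m → ((suc K * 2) * (m + m) / 2) % 2 ≡ 0
even-M-half K m = trans (cong (_% 2) (half-product (suc K * 2) m)) (trans (cong (_% 2) (regroup K m)) (even%2 (suc K * m)))
  where
    regroup : ∀ K m → (suc K * 2) * m ≡ suc K * m * 2
    regroup = solve-∀

odd-M-half : ∀ K m → ((3 + K * 2) * (m + m) / 2) % 2 ≡ m % 2
odd-M-half K m = trans (cong (_% 2) (half-product (3 + K * 2) m)) (trans (cong (_% 2) (regroup K m)) ([m+kn]%n≡m%n m (m + K * m) 2))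
  where
    regroup : ∀ K m → (3 + K * 2) * m ≡ m + (m + K * m) * 2
    regroup = solve-∀

odd-odd-mod4 : ∀ K h → ((3 + K * 2) * ((3 + h * 2) + (3 + h * 2))) % 4 ≡ 2
odd-odd-mod4 K h = trans (cong (_% 4) (regroup K h)) ([m+kn]%n≡m%n 2 (4 + h * 3 + K * 3 + K * h * 2) 4)
  where
    regroup : ∀ K h → (3 + K * 2) * ((3 + h * 2) + (3 + h * 2)) ≡ 2 + (4 + h * 3 + K * 3 + K * h * 2) * 4
    regroup = solve-∀

twice : ∀ m → m * 2 ≡ m + m
twice m = trans (*-comm m 2) (cong (m +_) (+-identityʳ m))

-- n = 2 and M odd: β is odd, hence β = 1.
n=2 : ∀ K β → β ≤ 2 → β % 2 ≡ 1 → HWP (C[ 3 + K * 2 ] 2) (3 + K * 2) ((3 + K * 2) * 2) (2 ∸ β) β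
n=2 K 1 _ _ = TwoDesign.hwp K
n=2 K (suc (suc (suc _))) (s≤s (s≤s ())) _

theorem-for-even : ∀ m' M β → 3 ≤ M → 0 < β → β ≤ suc m' + suc m' →
  β % 2 ≡ ((M * (suc m' + suc m')) / 2) % 2 →
  ((M * (suc m' + suc m')) % 4 ≡ 2 → 2 < suc m' + suc m' → β ≢ 1) →
  HWP (C[ M ] (suc m' + suc m')) M (M * (suc m' + suc m')) ((suc m' + suc m') ∸ β) β
theorem-for-even m' M β M≥3 0<β β≤n parity-β n≢2mod4 with parity M
theorem-for-even m' .(0 * 2) β () _ _ _ _ | inj₁ (0 , refl)
theorem-for-even m' .(1 * 2) β (s≤s (s≤s ())) _ _ _ _ | inj₁ (1 , refl)
theorem-for-even m' .(suc K * 2) β M≥3 0<β β≤n parity-β n≢2mod4 | inj₁ (suc K , refl) with parity β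
... | inj₁ (k , refl) = EvenDesign.hwp (m' + suc m') K k _ M≥3 (m+[n∸m]≡n β≤n)
... | inj₂ (k , refl) = ⊥-elim (1+n≢0 (trans (sym (odd%2 k)) (trans parity-β (even-M-half K (suc m')))))
theorem-for-even m' .(1 + 0 * 2) β (s≤s ()) _ _ _ _ | inj₂ (0 , refl)
theorem-for-even m' .(1 + suc K * 2) β M≥3 0<β β≤n parity-β n≢2mod4 | inj₂ (suc K , refl) with parity m'
... | inj₁ (0 , refl) = n=2 K β β≤n (trans parity-β (odd-M-half K 1))
... | inj₂ (j , refl) with parity β
...   | inj₂ (k , refl) = ⊥-elim (1+n≢0 (trans (sym (odd%2 k)) (trans parity-β (trans (odd-M-half K (suc m')) (even%2 (suc j))))))
...   | inj₁ (0 , refl) = ⊥-elim (<-irrefl refl 0<β)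
...   | inj₁ (suc k , refl) = EvenHalfDesign.hwp j K k _ (m+[n∸m]≡n β≤n)
theorem-for-even m' .(1 + suc K * 2) β M≥3 0<β β≤n parity-β n≢2mod4 | inj₂ (suc K , refl) | inj₁ (suc h , refl) with parity β
...   | inj₁ (k , refl) = ⊥-elim (1+n≢0 (trans (sym (odd%2 (suc h))) (trans (sym (odd-M-half K (suc m'))) (trans (sym parity-β) (even%2 k)))))
...   | inj₂ (0 , refl) = ⊥-elim (n≢2mod4 (odd-odd-mod4 K h) (s≤s (s≤s (s≤s z≤n))) refl)
...   | inj₂ (suc k , refl) = OddHalfDesign.hwp h K k _ (m+[n∸m]≡n β≤n)

lemma3p3 : ∀ (n M β : ℕ) → 2 ∣ n → 2 ≤ n → 3 ≤ M → 0 < β → β ≤ n →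
    β % 2 ≡ ((M * n) / 2) % 2 →
    ((M * n) % 4 ≡ 2 → 2 < n → β ≢ 1) →
    HWP (C[ M ] n) M (M * n) (n ∸ β) β
lemma3p3 .(0 * 2) M β (divides zero refl) ()
lemma3p3 .(suc m' * 2) M β (divides (suc m') refl) 2≤n rewrite twice (suc m') = theorem-for-even m' M β
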